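{- Let $X,Y$ be lower Eulerian posets, $\sigma:X\to Y$ a strong formal subdivision with associated poset $\Gamma$, $r_\Gamma\in I(\Gamma)$ a weak rank function and $\kappa_\Gamma\in\mathcal{I}(\Gamma)\cap U(\Gamma)$ multiplicative and rank alternating (all as in the context). Then for all $x\in X$, $y\in Y$ with $\sigma(x)\le y$, \[\ell_\sigma(x,y;t)=t^{r_\Gamma(x,y)-1}\ell_\sigma(x,y;t^{ -1}).\] Equivalently, $(t-1)\cdot\ell_\sigma\in\mathcal{I}(\Gamma)$ is antisymmetric, i.e. $((t-1)\cdot\ell_\sigma)^{\mathrm{rev}}=-(t-1)\cdot\ell_\sigma$.
   Context: All posets are finite. For a poset $B$, the incidence algebra $I(B)$ is the set of functions from closed intervals $[z,z']$ of $B$ to $\mathbb{Z}[t]$ (value $p(z,z')=p(z,z';t)$), a $\mathbb{Z}[t]$-algebra with pointwise sum and scalars, product $(p\cdot p')(z,z')=\sum_{z\le z''\le z'}p(z,z'')p'(z'',z')$, unit $\delta_B$. A weak rank function is $r_B\in I(B)$ with nonnegative integer values, positive on $z<z'$, and $r_B(z,z')=r_B(z,z'')+r_B(z'',z')$. $\mathcal{I}(B)=\{p:\deg p(z,z')\le r_B(z,z')\}$, with involution $p^{\mathrm{rev}}(z,z';t)=t^{r_B(z,z')}p(z,z';t^{ -1})$; $\mathcal{I}_{1/2}(B)=\{p\in\mathcal{I}(B):\deg p(z,z')<r_B(z,z')/2$ for $z<z'\}$; $U(B)=\{p:p(z,z)=1\}$. A $B$-kernel is $\kappa\in\mathcal{I}(B)\cap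 U(B)$ with $\kappa^{ -1}=\kappa^{\mathrm{rev}}$, and its left KLS function is the unique $g_B\in\mathcal{I}_{1/2}(B)\cap U(B)$ with $g_B^{\mathrm{rev}}=g_B\cdot\kappa$. A poset is lower Eulerian if it has a unique minimal element, a rank function $\rho_B$ ($\rho_B(z')=\rho_B(z)+1$ when $z'$ covers $z$), and $\sum_{z\le z''\le z'}(-1)^{\rho_B(z'')}=0$ for $z<z'$; $\rho_B(z,z')=\rho_B(z')-\rho_B(z)$. For lower Eulerian $B$, $p$ is rank alternating if $p^{\mathrm{rev}}(z,z')=(-1)^{\rho_B(z,z')}p(z,z')$ for all $z\le z'$, and multiplicative if $p(z,z')=p(z,z'')p(z'',z')$ for all $z\le z''\le z'$; such $\kappa\in\mathcal{I}(B)\cap U(B)$ is a $B$-kernel. Setting: $X,Y$ lower Eulerian with rank functions $\rho_X,\rho_Y$; $\sigma:X\to Y$ a strong formal subdivision: order-preserving; $\rho_X(x)\le\rho_Y(\sigma(x))$; surjective with, for all $x\in X,y\in Y$ with $\sigma(x)\le y$, some $x'\ge x$ with $\rho_X(x')=\rho_Y(y)$, $\sigma(x')=y$; and $\sum_{x\le x'\in X,\sigma(x')=y}(-1)^{\rho_Y(y)-\rho_X(x')}=1$ for all such $x,y$. $\Gamma$ is the poset on $X\sqcup Y$ with the orders of $X$ and $Y$ and $x\le y$ ($x\in X,y\in Y$) iff $\sigma(x)\le y$; it is lower Eulerian with rank function $\rho_X$ on $X$ and $\rho_Y+1$ on $Y$. $g_\Gamma$ is the left KLS function of $\kappa_\Gamma$.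 For $p\in\mathcal{I}(\Gamma)$, $p|_{(X/Y)^\circ}$ agrees with $p$ on intervals $[x,\sigma(x)]$, $x\in X$, and is zero elsewhere. Define $h_\sigma,\ell_\sigma\in\mathcal{I}(\Gamma)$ by $(t-1)\cdot h_\sigma=g_\Gamma\cdot\kappa_\Gamma|_{(X/Y)^\circ}$ (the right side is divisible by $t-1$) and $\ell_\sigma=h_\sigma\cdot g_\Gamma^{ -1}$. -}

module Defs where

open import Level using (0ℓ)
open import Data.Nat as ℕ using (ℕ; zero; suc; _∸_; _≤ᵇ_)
open import Data.Integer as ℤ using (ℤ; 0ℤ; 1ℤ; _+_; _*_; -_; _-_)
open import Data.Bool using (Bool; true; false; _∧_; if_then_else_)
open import Data.List using (List; []; _∷_; _++_; map; foldr; upTo)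
open import Data.List.Membership.Propositional using (_∈_)
open import Data.List.Relation.Unary.Unique.Propositional using (Unique)
open import Data.Product using (Σ; ∃; _×_; _,_)
open import Data.Sum using (_⊎_; inj₁; inj₂)
open import Data.Empty using (⊥)
open import Data.Unit using (⊤)
open import Relation.Nullary using (¬_; Dec; yes; no; does)
open import Relation.Binary.PropositionalEquality using (_≡_; _≢_)

-- Polynomials in ℤ[t], represented by their coefficient sequences
-- (p n = coefficient of t^n).  Equality is pointwise.

Poly : Set
Poly = ℕ → ℤ

sumℤ : List ℤ → ℤ
sumℤ = foldr _+_ 0ℤ

0ₚ : Poly
0ₚ _ = 0ℤ

1ₚ : Poly
1ₚ zero    = 1ℤ
1ₚ (suc _) = 0ℤ

_+ₚ_ : Poly → Poly → Poly
(p +ₚ q) n = p n + q n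

_*ₚ_ : Poly → Poly → Poly
(p *ₚ q) n = sumℤ (map (λ i → p i * q (n ∸ i)) (upTo (suc n)))

tMinus1* : Poly → Poly
tMinus1* p zero    = - p zero
tMinus1* p (suc n) = p n - p (suc n)

sgn : ℕ → ℤ
sgn zero    = 1ℤ
sgn (suc n) = - sgn n

-- revBy d p = t^d p(t^{-1})  (as a polynomial when deg p ≤ d;
-- coefficients of p above degree d are dropped)
revBy : ℕ → Poly → Poly
revBy d p n = if n ≤ᵇ d then p (d ∸ n) else 0ℤ

IsPoly : Poly → Set
IsPoly p = ∃ λ N → ∀ n → N ℕ.≤ n → p n ≡ 0ℤ

DegLe : Poly → ℕ → Set
DegLe p d = ∀ n → d ℕ.< n → p n ≡ 0ℤ

DegLtHalf : Poly → ℕ → Set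
DegLtHalf p r = ∀ n → r ℕ.≤ 2 ℕ.* n → p n ≡ 0ℤ

record FinPoset : Set₁ where
  field
    Carrier   : Set
    _≤_       : Carrier → Carrier → Set
    _≤?_      : (x y : Carrier) → Dec (x ≤ y)
    elems     : List Carrier
    complete  : ∀ x → x ∈ elems
    unique    : Unique elems
    ≤-refl    : ∀ x → x ≤ x
    ≤-trans   : ∀ x y z → x ≤ y → y ≤ z → x ≤ z
    ≤-antisym : ∀ x y → x ≤ y → y ≤ x → x ≡ y

-- Incidence algebra over a finite "ordered" carrier.
-- An element of I(B) is a function on pairs; only its values on closed
-- intervals [z,z'] (z ≤ z') matter, and equality is taken on intervals.

module Incidence {C : Set} (_≤_ : C → C → Set)
                 (_≤?_ : (x y : C) → Dec (x ≤ y)) (elems : List C) where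

  leb : C → C → Bool
  leb x y = does (x ≤? y)

  -- decidable equality, valid since ≤ is antisymmetric
  eqb : C → C → Bool
  eqb x y = leb x y ∧ leb y x

  _<_ : C → C → Set
  z < z' = (z ≤ z') × (z ≢ z')

  sumWhere : (C → Bool) → (C → ℤ) → ℤ
  sumWhere b f = sumℤ (map (λ w → if b w then f w else 0ℤ) elems)

  sumInterval : C → C → (C → ℤ) → ℤ
  sumInterval z z' f = sumWhere (λ w → leb z w ∧ leb w z') f

  Inc : Set
  Inc = C → C → Poly

  _·_ : Inc → Inc → Inc
  (p · q) z z' n = sumInterval z z' (λ w → (p z w *ₚ q w z') n)

  δ : Inc
  δ z z' = if eqb z z' then 1ₚ else 0ₚ

  tMinus1·_ : Inc → Inc
  (tMinus1· p) z z' = tMinus1* (p z z')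

  _≈_ : Inc → Inc → Set
  p ≈ q = ∀ z z' → z ≤ z' → ∀ n → p z z' n ≡ q z z' n

  IsPolyValued : Inc → Set
  IsPolyValued p = ∀ z z' → z ≤ z' → IsPoly (p z z')

  IsWeakRank : (C → C → ℕ) → Set
  IsWeakRank r = (∀ z z' → z < z' → 0 ℕ.< r z z')
               × (∀ z w z' → z ≤ w → w ≤ z' → r z z' ≡ r z w ℕ.+ r w z')

  In𝓘 : (C → C → ℕ) → Inc → Set
  In𝓘 r p = ∀ z z' → z ≤ z' → DegLe (p z z') (r z z')

  In𝓘half : (C → C → ℕ) → Inc → Set
  In𝓘half r p = In𝓘 r p × (∀ z z' → z < z' → DegLtHalf (p z z') (r z z'))

  rev : (C → C → ℕ) → Inc → Inc
  rev r p z z' = revBy (r z z') (p z z')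

  InU : Inc → Set
  InU p = ∀ z n → p z z n ≡ 1ₚ n

  IsInverse : Inc → Inc → Set
  IsInverse p q = ((p · q) ≈ δ) × ((q · p) ≈ δ)

  IsLeftKLS : (C → C → ℕ) → Inc → Inc → Set
  IsLeftKLS r κ g = In𝓘half r g × InU g × (rev r g ≈ (g · κ))

  Multiplicative : Inc → Set
  Multiplicative κ = ∀ z w z' → z ≤ w → w ≤ z' →
                     ∀ n → κ z z' n ≡ (κ z w *ₚ κ w z') n

  -- κ^rev(z,z') = (-1)^{ρ(z') - ρ(z)} κ(z,z')   ((-1)^{a-b} = (-1)^{a+b})
  RankAlternating : (C → ℕ) → (C → C → ℕ) → Inc → Set
  RankAlternating ρ r κ = ∀ z z' → z ≤ z' →
                          ∀ n → rev r κ z z' n ≡ sgn (ρ z ℕ.+ ρ z') * κ z z' n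

module _ (B : FinPoset) where
  open FinPoset B
  open Incidence _≤_ _≤?_ elems

  Minimal : Carrier → Set
  Minimal m = ∀ z → z ≤ m → z ≡ m

  HasUniqueMinimal : Set
  HasUniqueMinimal = Σ Carrier λ m → Minimal m × (∀ m' → Minimal m' → m' ≡ m)

  Covers : Carrier → Carrier → Set
  Covers z z' = z < z' × ¬ (Σ Carrier λ w → z < w × w < z')

  IsRankFunction : (Carrier → ℕ) → Set
  IsRankFunction ρ = ∀ z z' → Covers z z' → ρ z' ≡ suc (ρ z)

  IsLowerEulerian : (Carrier → ℕ) → Set
  IsLowerEulerian ρ = HasUniqueMinimal × IsRankFunction ρ
                    × (∀ z z' → z < z' → sumInterval z z' (λ w → sgn (ρ w)) ≡ 0ℤ)

module Subdivision (X Y : FinPoset) where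
  private
    module X = FinPoset X
    module Y = FinPoset Y
    module IX = Incidence X._≤_ X._≤?_ X.elems
    module IY = Incidence Y._≤_ Y._≤?_ Y.elems

  IsStrongFormalSubdivision : (X.Carrier → ℕ) → (Y.Carrier → ℕ)
                            → (X.Carrier → Y.Carrier) → Set
  IsStrongFormalSubdivision ρX ρY σ =
      (∀ x x' → x X.≤ x' → σ x Y.≤ σ x')
    × (∀ x → ρX x ℕ.≤ ρY (σ x))
    × (∀ y → ∃ λ x → σ x ≡ y)
    × (∀ x y → σ x Y.≤ y → ∃ λ x' → x X.≤ x' × ρX x' ≡ ρY y × σ x' ≡ y)
    × (∀ x y → σ x Y.≤ y →
         IX.sumWhere (λ x' → IX.leb x x' ∧ IY.eqb (σ x') y)
                     (λ x' → sgn (ρY y ℕ.+ ρX x')) ≡ 1ℤ)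

  module Γ (σ : X.Carrier → Y.Carrier) where
    Carrier : Set
    Carrier = X.Carrier ⊎ Y.Carrier

    _≤_ : Carrier → Carrier → Set
    inj₁ x ≤ inj₁ x' = x X.≤ x'
    inj₁ x ≤ inj₂ y  = σ x Y.≤ y
    inj₂ y ≤ inj₁ x  = ⊥
    inj₂ y ≤ inj₂ y' = y Y.≤ y'

    _≤?_ : (a b : Carrier) → Dec (a ≤ b)
    inj₁ x ≤? inj₁ x' = x X.≤? x'
    inj₁ x ≤? inj₂ y  = σ x Y.≤? y
    inj₂ y ≤? inj₁ x  = no (λ ())
    inj₂ y ≤? inj₂ y' = y Y.≤? y'

    elems : List Carrier
    elems = map inj₁ X.elems ++ map inj₂ Y.elems

    ρΓ : (X.Carrier → ℕ) → (Y.Carrier → ℕ) → Carrier → ℕ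
    ρΓ ρX ρY (inj₁ x) = ρX x
    ρΓ ρX ρY (inj₂ y) = suc (ρY y)

    open Incidence _≤_ _≤?_ elems public

    restrictXY : Inc → Inc
    restrictXY p (inj₁ x) (inj₂ y) = if IY.eqb (σ x) y then p (inj₁ x) (inj₂ y) else 0ₚ
    restrictXY p (inj₁ x) (inj₁ x') = 0ₚ
    restrictXY p (inj₂ y) _ = 0ₚ

{-# OPTIONS --safe #-}
-- Write k = κ|_{(X/Y)°}, so that (t - 1) ℓ = (t - 1) h g⁻¹ = g k g⁻¹.  Reversal is multiplicative
-- on 𝓘(Γ), g^rev = g κ, and g⁻¹ g = δ gives κ (g⁻¹)^rev = g⁻¹; hence
-- ((t - 1) ℓ)^rev = g κ k^rev (g⁻¹)^rev.  On an interval [x, y], multiplicativity and rank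
-- alternation of κ turn (κ k^rev)(x, y) into -κ(x, y) times the alternating sum defining a strong
-- formal subdivision, which is 1; so κ k^rev = -k κ and ((t - 1) ℓ)^rev = -(t - 1) ℓ.  Finally
-- deg ℓ(x, y) < r(x, y) and t - 1 is injective on polynomials, so the antisymmetry of
-- (t - 1) ℓ(x, y) under reversal of degree r(x, y) forces the symmetry of ℓ(x, y) in degree r(x, y) - 1.

module Submission where

open import Defs
open import Data.Nat using (ℕ; _∸_)
open import Data.Sum using (inj₁; inj₂)
open import Relation.Binary.PropositionalEquality using (_≡_)

import Algebra.Properties.CommutativeSemigroup as CommutativeSemigroupProperties
open import Data.Bool using (Bool; true; false; _∧_; if_then_else_; T)
open import Data.Bool.Properties using (T-∧; T?)
open import Data.Empty using (⊥-elim)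
open import Data.Integer using (ℤ; 0ℤ; 1ℤ; -1ℤ; _+_; _*_; -_; _-_)
import Data.Integer.Properties as ℤP
open import Data.Integer.Tactic.RingSolver using (solve-∀)
open import Data.List using (List; []; _∷_; _++_; map; upTo; [_])
import Data.List.Properties as ListP
open import Data.List.Membership.Propositional using (_∈_)
open import Data.List.Membership.Propositional.Properties
  using (∈-upTo⁺; ∈-upTo⁻; ∈-map⁺; ∈-map⁻; ∈-++⁺ˡ; ∈-++⁺ʳ)
import Data.List.Relation.Unary.All as All
open import Data.List.Relation.Unary.AllPairs using (_∷_)
open import Data.List.Relation.Unary.Any using (here; there)
open import Data.List.Relation.Unary.Unique.Propositional using (Unique)
import Data.List.Relation.Unary.Unique.Propositional.Properties as UniqueP
open import Data.Nat as ℕ using (zero; suc; _≤ᵇ_; _≡ᵇ_; z≤n; s≤s)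
open import Data.Nat.Induction using (<-rec)
import Data.Nat.Properties as ℕP
open import Data.Product using (_×_; _,_; proj₁; proj₂)
open import Data.Product.Function.NonDependent.Propositional using (_×-⇔_)
open import Data.Sum.Properties using (inj₁-injective; inj₂-injective)
open import Data.Unit using (tt)
open import Function.Bundles using (_⇔_; mk⇔; Equivalence)
import Function.Properties.Equivalence as ⇔
open import Level using (0ℓ)
open import Relation.Binary.Bundles using (Setoid)
open import Relation.Binary.Definitions using (DecidableEquality)
open import Relation.Binary.PropositionalEquality
  using (refl; sym; trans; cong; cong₂; subst; _≢_; _≗_; module ≡-Reasoning)
open import Relation.Nullary using (¬_; yes; no; map′; does)

private
  module ℤ+ = CommutativeSemigroupProperties ℤP.+-commutativeSemigroup
  module ℕ+ = CommutativeSemigroupProperties ℕP.+-commutativeSemigroup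

-- Finite sums over lists

∑ : {A : Set} → List A → (A → ℤ) → ℤ
∑ xs f = sumℤ (map f xs)

module _ {A : Set} where

  ∑-cong : (xs : List A) {f g : A → ℤ} → (∀ a → a ∈ xs → f a ≡ g a) → ∑ xs f ≡ ∑ xs g
  ∑-cong []       _  = refl
  ∑-cong (x ∷ xs) eq = cong₂ _+_ (eq x (here refl)) (∑-cong xs (λ a a∈ → eq a (there a∈)))

  ∑-zero : (xs : List A) {f : A → ℤ} → (∀ a → a ∈ xs → f a ≡ 0ℤ) → ∑ xs f ≡ 0ℤ
  ∑-zero []       _  = refl
  ∑-zero (x ∷ xs) eq = cong₂ _+_ (eq x (here refl)) (∑-zero xs (λ a a∈ → eq a (there a∈)))

  ∑-+ : (xs : List A) (f g : A → ℤ) → ∑ xs (λ a → f a + g a) ≡ ∑ xs f + ∑ xs g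
  ∑-+ []       f g = refl
  ∑-+ (x ∷ xs) f g = trans (cong (f x + g x +_) (∑-+ xs f g)) (ℤ+.interchange (f x) (g x) (∑ xs f) (∑ xs g))

  ∑-*ˡ : (xs : List A) (c : ℤ) (f : A → ℤ) → ∑ xs (λ a → c * f a) ≡ c * ∑ xs f
  ∑-*ˡ []       c f = sym (ℤP.*-zeroʳ c)
  ∑-*ˡ (x ∷ xs) c f = trans (cong (c * f x +_) (∑-*ˡ xs c f)) (sym (ℤP.*-distribˡ-+ c (f x) (∑ xs f)))

  ∑-*ʳ : (xs : List A) (c : ℤ) (f : A → ℤ) → ∑ xs (λ a → f a * c) ≡ ∑ xs f * c
  ∑-*ʳ []       c f = refl
  ∑-*ʳ (x ∷ xs) c f = trans (cong (f x * c +_) (∑-*ʳ xs c f)) (sym (ℤP.*-distribʳ-+ c (f x) (∑ xs f)))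

  ∑-neg : (xs : List A) (f : A → ℤ) → ∑ xs (λ a → - f a) ≡ - ∑ xs f
  ∑-neg []       f = refl
  ∑-neg (x ∷ xs) f = trans (cong (- f x +_) (∑-neg xs f)) (sym (ℤP.neg-distrib-+ (f x) (∑ xs f)))

  ∑-++ : (xs ys : List A) (f : A → ℤ) → ∑ (xs ++ ys) f ≡ ∑ xs f + ∑ ys f
  ∑-++ []       ys f = sym (ℤP.+-identityˡ _)
  ∑-++ (x ∷ xs) ys f = trans (cong (f x +_) (∑-++ xs ys f)) (sym (ℤP.+-assoc (f x) (∑ xs f) (∑ ys f)))

  ∑-map : {B : Set} (xs : List B) (g : B → A) (f : A → ℤ) → ∑ (map g xs) f ≡ ∑ xs (λ b → f (g b))
  ∑-map xs g f = cong sumℤ (sym (ListP.map-∘ xs))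

  ∑-single : (xs : List A) → Unique xs → ∀ {x} → x ∈ xs → (f : A → ℤ) →
             (∀ a → a ∈ xs → a ≢ x → f a ≡ 0ℤ) → ∑ xs f ≡ f x
  ∑-single (y ∷ xs) (y∉ ∷ u) (here refl) f others =
    trans (cong (f y +_) (∑-zero xs (λ a a∈ → others a (there a∈) (λ { refl → All.lookup y∉ a∈ refl }))))
          (ℤP.+-identityʳ (f y))
  ∑-single (y ∷ xs) (y∉ ∷ u) (there x∈) f others =
    trans (cong (_+ ∑ xs f) (others y (here refl) (λ { refl → All.lookup y∉ x∈ refl })))
          (trans (ℤP.+-identityˡ _) (∑-single xs u x∈ f (λ a a∈ → others a (there a∈))))

∑-swap : {A B : Set} (xs : List A) (ys : List B) (f : A → B → ℤ) →
         ∑ xs (λ a → ∑ ys (f a)) ≡ ∑ ys (λ b → ∑ xs (λ a → f a b))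
∑-swap []       ys f = sym (∑-zero ys (λ _ _ → refl))
∑-swap (x ∷ xs) ys f = trans (cong (∑ ys (f x) +_) (∑-swap xs ys f)) (sym (∑-+ ys (f x) _))

-- The summands of Incidence.sumWhere are definitionally of this form.
onlyIf : Bool → ℤ → ℤ
onlyIf b x = if b then x else 0ℤ

onlyIf-true : ∀ {b} x → T b → onlyIf b x ≡ x
onlyIf-true {true} x _ = refl

onlyIf-zero : ∀ b {x} → (T b → x ≡ 0ℤ) → onlyIf b x ≡ 0ℤ
onlyIf-zero true  x≡0 = x≡0 tt
onlyIf-zero false _   = refl

onlyIf-false : ∀ {b} x → ¬ T b → onlyIf b x ≡ 0ℤ
onlyIf-false {b} x ¬b = onlyIf-zero b (λ t → ⊥-elim (¬b t))

onlyIf-cong : ∀ b {x y} → (T b → x ≡ y) → onlyIf b x ≡ onlyIf b y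
onlyIf-cong true  x≡y = x≡y tt
onlyIf-cong false _   = refl

onlyIf-∧ : ∀ a b x → onlyIf a (onlyIf b x) ≡ onlyIf (a ∧ b) x
onlyIf-∧ true  b x = refl
onlyIf-∧ false b x = refl

onlyIf-*ˡ : ∀ b c x → c * onlyIf b x ≡ onlyIf b (c * x)
onlyIf-*ˡ true  c x = refl
onlyIf-*ˡ false c x = ℤP.*-zeroʳ c

onlyIf-*ʳ : ∀ b c x → onlyIf b x * c ≡ onlyIf b (x * c)
onlyIf-*ʳ true  c x = refl
onlyIf-*ʳ false c x = refl

onlyIf-∑ : ∀ {A : Set} b (xs : List A) f → onlyIf b (∑ xs f) ≡ ∑ xs (λ a → onlyIf b (f a))
onlyIf-∑ true  xs f = refl
onlyIf-∑ false xs f = sym (∑-zero xs (λ _ _ → refl))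

T-⇔⇒≡ : ∀ {a b} → T a ⇔ T b → a ≡ b
T-⇔⇒≡ {false} {false} _    = refl
T-⇔⇒≡ {false} {true}  a⇔b = ⊥-elim (Equivalence.from a⇔b tt)
T-⇔⇒≡ {true}  {false} a⇔b = ⊥-elim (Equivalence.to a⇔b tt)
T-⇔⇒≡ {true}  {true}  _    = refl

≡ᵇ-cong : ∀ {m n m' n'} → (m ≡ n ⇔ m' ≡ n') → (m ≡ᵇ n) ≡ (m' ≡ᵇ n')
≡ᵇ-cong {m} {n} {m'} {n'} e = T-⇔⇒≡ (mk⇔ (λ t → ℕP.≡⇒≡ᵇ m' n' (Equivalence.to e (ℕP.≡ᵇ⇒≡ m n t)))
                                        (λ t → ℕP.≡⇒≡ᵇ m n (Equivalence.from e (ℕP.≡ᵇ⇒≡ m' n' t))))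

onlyIf-≤ᵇ : ∀ {i m} x → i ℕ.≤ m → onlyIf (i ≤ᵇ m) x ≡ x
onlyIf-≤ᵇ x i≤m = onlyIf-true x (ℕP.≤⇒≤ᵇ i≤m)

onlyIf->ᵇ : ∀ {i m} x → m ℕ.< i → onlyIf (i ≤ᵇ m) x ≡ 0ℤ
onlyIf->ᵇ {i} {m} x m<i = onlyIf-false x (λ t → ℕP.<⇒≱ m<i (ℕP.≤ᵇ⇒≤ i m t))

m+n≡o⇒n≡o∸m : ∀ m n o → m ℕ.+ n ≡ o → n ≡ o ∸ m
m+n≡o⇒n≡o∸m m n o m+n≡o = trans (sym (ℕP.m+n∸m≡n m n)) (cong (_∸ m) m+n≡o)

∑≤ : ℕ → (ℕ → ℤ) → ℤ
∑≤ N f = ∑ (upTo (suc N)) f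

∑≤-cong : ∀ N {f g} → (∀ i → i ℕ.≤ N → f i ≡ g i) → ∑≤ N f ≡ ∑≤ N g
∑≤-cong N eq = ∑-cong (upTo (suc N)) (λ i i∈ → eq i (ℕP.≤-pred (∈-upTo⁻ i∈)))

∑≤-zero : ∀ N {f} → (∀ i → i ℕ.≤ N → f i ≡ 0ℤ) → ∑≤ N f ≡ 0ℤ
∑≤-zero N eq = ∑-zero (upTo (suc N)) (λ i i∈ → eq i (ℕP.≤-pred (∈-upTo⁻ i∈)))

∑≤-single : ∀ N {k} (f : ℕ → ℤ) → k ℕ.≤ N → (∀ i → i ℕ.≤ N → i ≢ k → f i ≡ 0ℤ) →
            ∑≤ N f ≡ f k
∑≤-single N f k≤N others =
  ∑-single (upTo (suc N)) (UniqueP.upTo⁺ (suc N)) (∈-upTo⁺ (s≤s k≤N)) f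
           (λ i i∈ → others i (ℕP.≤-pred (∈-upTo⁻ i∈)))

∑≤-onlyIf-unique : ∀ N {k} (c : ℕ → Bool) (f : ℕ → ℤ) → k ℕ.≤ N → T (c k) → (∀ i → T (c i) → i ≡ k) →
                   ∑≤ N (λ i → onlyIf (c i) (f i)) ≡ f k
∑≤-onlyIf-unique N {k} c f k≤N ck unique =
  trans (∑≤-single N (λ i → onlyIf (c i) (f i)) k≤N (λ i _ i≢k → onlyIf-false (f i) (λ ci → i≢k (unique i ci))))
        (onlyIf-true (f k) ck)

∑≤-suc : ∀ N (f : ℕ → ℤ) → ∑≤ (suc N) f ≡ ∑≤ N f + f (suc N)
∑≤-suc N f = begin
  ∑ (upTo (suc (suc N))) f         ≡⟨ cong (λ xs → ∑ xs f) (sym (ListP.upTo-∷ʳ (suc N))) ⟩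
  ∑ (upTo (suc N) ++ [ suc N ]) f  ≡⟨ ∑-++ (upTo (suc N)) [ suc N ] f ⟩
  ∑≤ N f + (f (suc N) + 0ℤ)        ≡⟨ cong (∑≤ N f +_) (ℤP.+-identityʳ _) ⟩
  ∑≤ N f + f (suc N)               ∎
  where open ≡-Reasoning

∑≤-extend : ∀ {n} N (f : ℕ → ℤ) → n ℕ.≤ N → (∀ i → n ℕ.< i → i ℕ.≤ N → f i ≡ 0ℤ) →
            ∑≤ N f ≡ ∑≤ n f
∑≤-extend zero    f z≤n  _      = refl
∑≤-extend (suc N) f n≤1+N vanish with ℕP.m≤n⇒m<n∨m≡n n≤1+N
... | inj₂ refl = refl
... | inj₁ n<1+N =
  trans (∑≤-suc N f)
        (trans (cong₂ _+_ (∑≤-extend N f (ℕP.≤-pred n<1+N) (λ i n<i i≤N → vanish i n<i (ℕP.m≤n⇒m≤1+n i≤N)))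
                          (vanish (suc N) n<1+N ℕP.≤-refl))
               (ℤP.+-identityʳ _))

∑≤-at : ∀ N c (f : ℕ → ℤ) → ∑≤ N (λ a → onlyIf (c ≡ᵇ a) (f a)) ≡ onlyIf (c ≤ᵇ N) (f c)
∑≤-at N c f with ℕP.≤-<-connex c N
... | inj₁ c≤N = trans (∑≤-onlyIf-unique N (c ≡ᵇ_) f c≤N (ℕP.≡⇒≡ᵇ c c refl) (λ a t → sym (ℕP.≡ᵇ⇒≡ c a t)))
                       (sym (onlyIf-≤ᵇ (f c) c≤N))
... | inj₂ N<c = trans (∑≤-zero N (λ a a≤N → onlyIf-false (f a) (λ t →
                         ℕP.<⇒≢ (ℕP.≤-<-trans a≤N N<c) (sym (ℕP.≡ᵇ⇒≡ c a t)))))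
                       (sym (onlyIf->ᵇ (f c) N<c))

∑≤-solve : ∀ B i m (g : ℕ → ℤ) → (B ℕ.< m ∸ i → g (m ∸ i) ≡ 0ℤ) →
           ∑≤ B (λ j → onlyIf (i ℕ.+ j ≡ᵇ m) (g j)) ≡ onlyIf (i ≤ᵇ m) (g (m ∸ i))
∑≤-solve B i m g g-vanish with ℕP.≤-<-connex i m
... | inj₂ m<i = trans (∑≤-zero B (λ j _ → onlyIf-false (g j) (λ t →
                         ℕP.<⇒≱ m<i (subst (i ℕ.≤_) (ℕP.≡ᵇ⇒≡ _ m t) (ℕP.m≤m+n i j)))))
                       (sym (onlyIf->ᵇ (g (m ∸ i)) m<i))
... | inj₁ i≤m = trans solution (sym (onlyIf-≤ᵇ (g (m ∸ i)) i≤m))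
  where
  unique : ∀ j → T (i ℕ.+ j ≡ᵇ m) → j ≡ m ∸ i
  unique j t = m+n≡o⇒n≡o∸m i j m (ℕP.≡ᵇ⇒≡ _ m t)
  solution : ∑≤ B (λ j → onlyIf (i ℕ.+ j ≡ᵇ m) (g j)) ≡ g (m ∸ i)
  solution with ℕP.≤-<-connex (m ∸ i) B
  ... | inj₁ m∸i≤B = ∑≤-onlyIf-unique B _ g m∸i≤B (ℕP.≡⇒≡ᵇ _ m (ℕP.m+[n∸m]≡n i≤m)) unique
  ... | inj₂ B<m∸i = trans (∑≤-zero B (λ j j≤B → onlyIf-false (g j) (λ t →
                             ℕP.<⇒≢ (ℕP.≤-<-trans j≤B B<m∸i) (unique j t))))
                           (sym (g-vanish B<m∸i))

-- Both sides equal the double sum of f j over the pairs with i + j = N.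
∑≤-reverse : ∀ N (f : ℕ → ℤ) → ∑≤ N (λ i → f (N ∸ i)) ≡ ∑≤ N f
∑≤-reverse N f = begin
  ∑≤ N (λ i → f (N ∸ i))
    ≡⟨ ∑≤-cong N (λ i i≤N → sym (pick-j i i≤N)) ⟩
  ∑≤ N (λ i → ∑≤ N (λ j → onlyIf (i ℕ.+ j ≡ᵇ N) (f j)))
    ≡⟨ ∑-swap (upTo (suc N)) (upTo (suc N)) (λ i j → onlyIf (i ℕ.+ j ≡ᵇ N) (f j)) ⟩
  ∑≤ N (λ j → ∑≤ N (λ i → onlyIf (i ℕ.+ j ≡ᵇ N) (f j)))
    ≡⟨ ∑≤-cong N pick-i ⟩
  ∑≤ N f
    ∎
  where
  open ≡-Reasoning
  pick-j : ∀ i → i ℕ.≤ N → ∑≤ N (λ j → onlyIf (i ℕ.+ j ≡ᵇ N) (f j)) ≡ f (N ∸ i)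
  pick-j i i≤N = trans (∑≤-solve N i N f (λ N<N∸i → ⊥-elim (ℕP.<⇒≱ N<N∸i (ℕP.m∸n≤m N i))))
                       (onlyIf-≤ᵇ (f (N ∸ i)) i≤N)
  pick-i : ∀ j → j ℕ.≤ N → ∑≤ N (λ i → onlyIf (i ℕ.+ j ≡ᵇ N) (f j)) ≡ f j
  pick-i j j≤N = ∑≤-onlyIf-unique N (λ i → i ℕ.+ j ≡ᵇ N) (λ _ → f j) (ℕP.m∸n≤m N j)
    (ℕP.≡⇒≡ᵇ _ N (ℕP.m∸n+n≡m j≤N))
    (λ i t → m+n≡o⇒n≡o∸m j i N (trans (ℕP.+-comm j i) (ℕP.≡ᵇ⇒≡ _ N t)))

-- Products and reversals of coefficient sequences

-- The part of the coefficient of t^m in p q coming from exponent pairs in [0,A] × [0,B].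
boxConv : ℕ → ℕ → Poly → Poly → ℕ → ℤ
boxConv A B p q m = ∑≤ A (λ i → ∑≤ B (λ j → onlyIf (i ℕ.+ j ≡ᵇ m) (p i * q j)))

*ₚ-boxConv : ∀ A B p q m → (∀ i → A ℕ.< i → i ℕ.≤ m → p i ≡ 0ℤ) →
             (∀ j → B ℕ.< j → j ℕ.≤ m → q j ≡ 0ℤ) → (p *ₚ q) m ≡ boxConv A B p q m
*ₚ-boxConv A B p q m p-vanish q-vanish = begin
  (p *ₚ q) m         ≡⟨ ∑≤-cong m (λ i i≤m → sym (onlyIf-≤ᵇ (p i * q (m ∸ i)) i≤m)) ⟩
  ∑≤ m F             ≡⟨ resize ⟩
  ∑≤ A F             ≡⟨ ∑≤-cong A (λ i _ → sym (column i)) ⟩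
  boxConv A B p q m  ∎
  where
  open ≡-Reasoning
  F : ℕ → ℤ
  F i = onlyIf (i ≤ᵇ m) (p i * q (m ∸ i))
  column : ∀ i → ∑≤ B (λ j → onlyIf (i ℕ.+ j ≡ᵇ m) (p i * q j)) ≡ F i
  column i = ∑≤-solve B i m (λ j → p i * q j)
    (λ B<m∸i → trans (cong (p i *_) (q-vanish (m ∸ i) B<m∸i (ℕP.m∸n≤m m i))) (ℤP.*-zeroʳ (p i)))
  resize : ∑≤ m F ≡ ∑≤ A F
  resize with ℕP.≤-total A m
  ... | inj₁ A≤m = ∑≤-extend m F A≤m (λ i A<i i≤m →
                     trans (onlyIf-≤ᵇ (p i * q (m ∸ i)) i≤m) (cong (_* q (m ∸ i)) (p-vanish i A<i i≤m)))
  ... | inj₂ m≤A = sym (∑≤-extend A F m≤A (λ i m<i _ → onlyIf->ᵇ (p i * q (m ∸ i)) m<i))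

*ₚ-boxConv-≤ : ∀ N p q {m} → m ℕ.≤ N → (p *ₚ q) m ≡ boxConv N N p q m
*ₚ-boxConv-≤ N p q {m} m≤N = *ₚ-boxConv N N p q m (λ i N<i i≤m → ⊥-elim (ℕP.<⇒≱ N<i (ℕP.≤-trans i≤m m≤N)))
                                                  (λ j N<j j≤m → ⊥-elim (ℕP.<⇒≱ N<j (ℕP.≤-trans j≤m m≤N)))

1ₚ-positive : ∀ {n} → 0 ℕ.< n → 1ₚ n ≡ 0ℤ
1ₚ-positive {suc _} _ = refl

*ₚ-cong : ∀ {p p' q q'} → p ≗ p' → q ≗ q' → (p *ₚ q) ≗ (p' *ₚ q')
*ₚ-cong p≗p' q≗q' n = ∑≤-cong n (λ i _ → cong₂ _*_ (p≗p' i) (q≗q' (n ∸ i)))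

*ₚ-congˡ : ∀ {p p'} q → p ≗ p' → (p *ₚ q) ≗ (p' *ₚ q)
*ₚ-congˡ q p≗p' n = ∑≤-cong n (λ i _ → cong (_* q (n ∸ i)) (p≗p' i))

*ₚ-congʳ : ∀ p {q q'} → q ≗ q' → (p *ₚ q) ≗ (p *ₚ q')
*ₚ-congʳ p q≗q' n = ∑≤-cong n (λ i _ → cong (p i *_) (q≗q' (n ∸ i)))

*ₚ-zeroˡ : ∀ {p} q → p ≗ 0ₚ → (p *ₚ q) ≗ 0ₚ
*ₚ-zeroˡ q p≗0 n = ∑≤-zero n (λ i _ → cong (_* q (n ∸ i)) (p≗0 i))

*ₚ-zeroʳ : ∀ p {q} → q ≗ 0ₚ → (p *ₚ q) ≗ 0ₚ
*ₚ-zeroʳ p q≗0 n = ∑≤-zero n (λ i _ → trans (cong (p i *_) (q≗0 (n ∸ i))) (ℤP.*-zeroʳ (p i)))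

*ₚ-identityˡ : ∀ p → (1ₚ *ₚ p) ≗ p
*ₚ-identityˡ p n =
  trans (∑≤-single n (λ i → 1ₚ i * p (n ∸ i)) z≤n (λ { zero _ 0≢0 → ⊥-elim (0≢0 refl) ; (suc i) _ _ → refl }))
        (ℤP.*-identityˡ (p n))

*ₚ-identityʳ : ∀ p → (p *ₚ 1ₚ) ≗ p
*ₚ-identityʳ p n = trans (∑≤-single n (λ i → p i * 1ₚ (n ∸ i)) ℕP.≤-refl others)
                         (trans (cong (λ k → p n * 1ₚ k) (ℕP.n∸n≡0 n)) (ℤP.*-identityʳ (p n)))
  where
  others : ∀ i → i ℕ.≤ n → i ≢ n → p i * 1ₚ (n ∸ i) ≡ 0ℤ
  others i i≤n i≢n with n ∸ i in eq
  ... | zero  = ⊥-elim (i≢n (ℕP.≤-antisym i≤n (ℕP.m∸n≡0⇒m≤n eq)))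
  ... | suc _ = ℤP.*-zeroʳ (p i)

*ₚ-∑ˡ : ∀ {A : Set} (xs : List A) (P : A → Poly) q →
        ((λ m → ∑ xs (λ a → P a m)) *ₚ q) ≗ (λ n → ∑ xs (λ a → (P a *ₚ q) n))
*ₚ-∑ˡ xs P q n = trans (∑≤-cong n (λ i _ → sym (∑-*ʳ xs (q (n ∸ i)) (λ a → P a i))))
                       (∑-swap (upTo (suc n)) xs (λ i a → P a i * q (n ∸ i)))

*ₚ-∑ʳ : ∀ {A : Set} (xs : List A) p (Q : A → Poly) →
        (p *ₚ (λ m → ∑ xs (λ a → Q a m))) ≗ (λ n → ∑ xs (λ a → (p *ₚ Q a) n))
*ₚ-∑ʳ xs p Q n = trans (∑≤-cong n (λ i _ → sym (∑-*ˡ xs (p i) (λ a → Q a (n ∸ i)))))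
                       (∑-swap (upTo (suc n)) xs (λ i a → p i * Q a (n ∸ i)))

*ₚ-onlyIfˡ : ∀ b p q → ((λ m → onlyIf b (p m)) *ₚ q) ≗ (λ n → onlyIf b ((p *ₚ q) n))
*ₚ-onlyIfˡ true  p q n = refl
*ₚ-onlyIfˡ false p q n = *ₚ-zeroˡ q (λ _ → refl) n

*ₚ-onlyIfʳ : ∀ b p q → (p *ₚ (λ m → onlyIf b (q m))) ≗ (λ n → onlyIf b ((p *ₚ q) n))
*ₚ-onlyIfʳ true  p q n = refl
*ₚ-onlyIfʳ false p q n = *ₚ-zeroʳ p (λ _ → refl) n

*ₚ-scalˡ : ∀ c p q → ((λ m → c * p m) *ₚ q) ≗ (λ n → c * (p *ₚ q) n)
*ₚ-scalˡ c p q n = trans (∑≤-cong n (λ i _ → ℤP.*-assoc c (p i) (q (n ∸ i))))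
                         (∑-*ˡ (upTo (suc n)) c (λ i → p i * q (n ∸ i)))

*ₚ-scalʳ : ∀ c p q → (p *ₚ (λ m → c * q m)) ≗ (λ n → c * (p *ₚ q) n)
*ₚ-scalʳ c p q n = trans (∑≤-cong n (λ i _ → x*[c*y]≡c*[x*y] (p i) (q (n ∸ i))))
                         (∑-*ˡ (upTo (suc n)) c (λ i → p i * q (n ∸ i)))
  where
  x*[c*y]≡c*[x*y] : ∀ x y → x * (c * y) ≡ c * (x * y)
  x*[c*y]≡c*[x*y] x y = trans (sym (ℤP.*-assoc x c y)) (trans (cong (_* y) (ℤP.*-comm x c)) (ℤP.*-assoc c x y))

-- Both sides are the sum of p i * q j * s k over i + j + k = n.
*ₚ-assoc : ∀ p q s → ((p *ₚ q) *ₚ s) ≗ (p *ₚ (q *ₚ s))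
*ₚ-assoc p q s n = trans left (sym right)
  where
  open ≡-Reasoning
  L : List ℕ
  L = upTo (suc n)
  term : ℕ → ℕ → ℕ → ℤ
  term i j k = onlyIf ((i ℕ.+ j) ℕ.+ k ≡ᵇ n) (p i * q j * s k)
  triple : ℤ
  triple = ∑≤ n (λ i → ∑≤ n (λ j → ∑≤ n (term i j)))
  right : (p *ₚ (q *ₚ s)) n ≡ triple
  right = ∑≤-cong n λ i i≤n → begin
    p i * (q *ₚ s) (n ∸ i)
      ≡⟨ cong (p i *_) (*ₚ-boxConv-≤ n q s (ℕP.m∸n≤m n i)) ⟩
    p i * boxConv n n q s (n ∸ i)
      ≡⟨ sym (∑-*ˡ L (p i) (λ j → ∑≤ n (λ k → onlyIf (j ℕ.+ k ≡ᵇ n ∸ i) (q j * s k)))) ⟩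
    ∑≤ n (λ j → p i * ∑≤ n (λ k → onlyIf (j ℕ.+ k ≡ᵇ n ∸ i) (q j * s k)))
      ≡⟨ ∑≤-cong n (λ j _ → sym (∑-*ˡ L (p i) (λ k → onlyIf (j ℕ.+ k ≡ᵇ n ∸ i) (q j * s k)))) ⟩
    ∑≤ n (λ j → ∑≤ n (λ k → p i * onlyIf (j ℕ.+ k ≡ᵇ n ∸ i) (q j * s k)))
      ≡⟨ ∑≤-cong n (λ j _ → ∑≤-cong n (λ k _ → trans (onlyIf-*ˡ (j ℕ.+ k ≡ᵇ n ∸ i) (p i) (q j * s k))
           (cong₂ onlyIf (≡ᵇ-cong (shift i j k i≤n)) (sym (ℤP.*-assoc (p i) (q j) (s k)))))) ⟩
    ∑≤ n (λ j → ∑≤ n (term i j)) ∎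
    where
    shift : ∀ i j k → i ℕ.≤ n → (j ℕ.+ k ≡ n ∸ i) ⇔ ((i ℕ.+ j) ℕ.+ k ≡ n)
    shift i j k i≤n = mk⇔ (λ e → trans (ℕP.+-assoc i j k) (trans (cong (i ℕ.+_) e) (ℕP.m+[n∸m]≡n i≤n)))
                          (λ e → m+n≡o⇒n≡o∸m i (j ℕ.+ k) n (trans (sym (ℕP.+-assoc i j k)) e))
  left : ((p *ₚ q) *ₚ s) n ≡ triple
  left = begin
    ∑≤ n (λ a → (p *ₚ q) a * s (n ∸ a))
      ≡⟨ ∑≤-cong n (λ a a≤n → cong (_* s (n ∸ a)) (*ₚ-boxConv-≤ n p q a≤n)) ⟩
    ∑≤ n (λ a → boxConv n n p q a * s (n ∸ a))
      ≡⟨ ∑≤-cong n (λ a _ → distribute a) ⟩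
    ∑≤ n (λ a → ∑≤ n (λ i → ∑≤ n (λ j → onlyIf (i ℕ.+ j ≡ᵇ a) (p i * q j * s (n ∸ a)))))
      ≡⟨ ∑-swap L L (λ a i → ∑≤ n (λ j → onlyIf (i ℕ.+ j ≡ᵇ a) (p i * q j * s (n ∸ a)))) ⟩
    ∑≤ n (λ i → ∑≤ n (λ a → ∑≤ n (λ j → onlyIf (i ℕ.+ j ≡ᵇ a) (p i * q j * s (n ∸ a)))))
      ≡⟨ ∑≤-cong n (λ i _ → ∑-swap L L (λ a j → onlyIf (i ℕ.+ j ≡ᵇ a) (p i * q j * s (n ∸ a)))) ⟩
    ∑≤ n (λ i → ∑≤ n (λ j → ∑≤ n (λ a → onlyIf (i ℕ.+ j ≡ᵇ a) (p i * q j * s (n ∸ a)))))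
      ≡⟨ ∑≤-cong n (λ i _ → ∑≤-cong n (λ j _ →
           trans (∑≤-at n (i ℕ.+ j) (λ a → p i * q j * s (n ∸ a)))
                 (sym (∑≤-solve n (i ℕ.+ j) n (λ k → p i * q j * s k)
                                (λ n<n∸ij → ⊥-elim (ℕP.<⇒≱ n<n∸ij (ℕP.m∸n≤m n (i ℕ.+ j)))))))) ⟩
    triple ∎
    where
    distribute : ∀ a → boxConv n n p q a * s (n ∸ a)
                     ≡ ∑≤ n (λ i → ∑≤ n (λ j → onlyIf (i ℕ.+ j ≡ᵇ a) (p i * q j * s (n ∸ a))))
    distribute a =
      trans (sym (∑-*ʳ L c (λ i → ∑≤ n (λ j → onlyIf (i ℕ.+ j ≡ᵇ a) (p i * q j)))))
            (∑≤-cong n (λ i _ → trans (sym (∑-*ʳ L c (λ j → onlyIf (i ℕ.+ j ≡ᵇ a) (p i * q j))))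
                                      (∑≤-cong n (λ j _ → onlyIf-*ʳ (i ℕ.+ j ≡ᵇ a) c (p i * q j)))))
      where
      c : ℤ
      c = s (n ∸ a)

revBy-≤ : ∀ {d n} p → n ℕ.≤ d → revBy d p n ≡ p (d ∸ n)
revBy-≤ {d} {n} p = onlyIf-≤ᵇ (p (d ∸ n))

revBy-> : ∀ {d n} p → d ℕ.< n → revBy d p n ≡ 0ℤ
revBy-> {d} {n} p = onlyIf->ᵇ (p (d ∸ n))

revBy-cong : ∀ d {p q} → p ≗ q → revBy d p ≗ revBy d q
revBy-cong d p≗q n = onlyIf-cong (n ≤ᵇ d) (λ _ → p≗q (d ∸ n))

revBy-0ₚ : ∀ d → revBy d 0ₚ ≗ 0ₚ
revBy-0ₚ d n = onlyIf-zero (n ≤ᵇ d) (λ _ → refl)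

revBy-∑ : ∀ {A : Set} d (xs : List A) (P : A → Poly) →
          revBy d (λ m → ∑ xs (λ a → P a m)) ≗ (λ n → ∑ xs (λ a → revBy d (P a) n))
revBy-∑ d xs P n = onlyIf-∑ (n ≤ᵇ d) xs (λ a → P a (d ∸ n))

revBy-onlyIf : ∀ d b p → revBy d (λ m → onlyIf b (p m)) ≗ (λ n → onlyIf b (revBy d p n))
revBy-onlyIf d true  p n = refl
revBy-onlyIf d false p n = revBy-0ₚ d n

reflect-≡ : ∀ {a b i j n} → i ℕ.≤ a → j ℕ.≤ b → n ℕ.≤ a ℕ.+ b →
            (i ℕ.+ j ≡ a ℕ.+ b ∸ n) ⇔ ((a ∸ i) ℕ.+ (b ∸ j) ≡ n)
reflect-≡ {a} {b} {i} {j} {n} i≤a j≤b n≤a+b = mk⇔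
  (λ e → ℕP.+-cancelʳ-≡ (i ℕ.+ j) _ _ (trans split (trans (sym (ℕP.m+[n∸m]≡n n≤a+b)) (cong (n ℕ.+_) (sym e)))))
  (λ e → m+n≡o⇒n≡o∸m n (i ℕ.+ j) (a ℕ.+ b) (trans (cong (ℕ._+ (i ℕ.+ j)) (sym e)) split))
  where
  split : ((a ∸ i) ℕ.+ (b ∸ j)) ℕ.+ (i ℕ.+ j) ≡ a ℕ.+ b
  split = trans (ℕ+.interchange (a ∸ i) (b ∸ j) i j) (cong₂ ℕ._+_ (ℕP.m∸n+n≡m i≤a) (ℕP.m∸n+n≡m j≤b))

-- Reversing both factors reverses the box [0,a] × [0,b] of exponent pairs.
revBy-*ₚ : ∀ a b p q → DegLe p a → DegLe q b → revBy (a ℕ.+ b) (p *ₚ q) ≗ (revBy a p *ₚ revBy b q)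
revBy-*ₚ a b p q p≤a q≤b n with ℕP.≤-<-connex n (a ℕ.+ b)
... | inj₁ n≤a+b = begin
  revBy (a ℕ.+ b) (p *ₚ q) n
    ≡⟨ revBy-≤ (p *ₚ q) n≤a+b ⟩
  (p *ₚ q) (a ℕ.+ b ∸ n)
    ≡⟨ *ₚ-boxConv a b p q _ (λ i a<i _ → p≤a i a<i) (λ j b<j _ → q≤b j b<j) ⟩
  boxConv a b p q (a ℕ.+ b ∸ n)
    ≡⟨ ∑≤-cong a (λ i i≤a → ∑≤-cong b (λ j j≤b → reflect i j i≤a j≤b)) ⟩
  ∑≤ a (λ i → ∑≤ b (λ j → G (a ∸ i) (b ∸ j)))
    ≡⟨ ∑≤-reverse a (λ i → ∑≤ b (λ j → G i (b ∸ j))) ⟩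
  ∑≤ a (λ i → ∑≤ b (λ j → G i (b ∸ j)))
    ≡⟨ ∑≤-cong a (λ i _ → ∑≤-reverse b (G i)) ⟩
  boxConv a b p' q' n
    ≡⟨ sym (*ₚ-boxConv a b p' q' n (λ i a<i _ → revBy-> p a<i) (λ j b<j _ → revBy-> q b<j)) ⟩
  (p' *ₚ q') n
    ∎
  where
  open ≡-Reasoning
  p' q' : Poly
  p' = revBy a p
  q' = revBy b q
  G : ℕ → ℕ → ℤ
  G i j = onlyIf (i ℕ.+ j ≡ᵇ n) (p' i * q' j)
  reflect : ∀ i j → i ℕ.≤ a → j ℕ.≤ b → onlyIf (i ℕ.+ j ≡ᵇ a ℕ.+ b ∸ n) (p i * q j) ≡ G (a ∸ i) (b ∸ j)
  reflect i j i≤a j≤b = cong₂ onlyIf (≡ᵇ-cong (reflect-≡ i≤a j≤b n≤a+b))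
    (sym (cong₂ _*_ (trans (revBy-≤ p (ℕP.m∸n≤m a i)) (cong p (ℕP.m∸[m∸n]≡n i≤a)))
                    (trans (revBy-≤ q (ℕP.m∸n≤m b j)) (cong q (ℕP.m∸[m∸n]≡n j≤b)))))
... | inj₂ a+b<n = trans (revBy-> (p *ₚ q) a+b<n) (sym (trans
  (*ₚ-boxConv a b (revBy a p) (revBy b q) n (λ i a<i _ → revBy-> p a<i) (λ j b<j _ → revBy-> q b<j))
  (∑≤-zero a (λ i i≤a → ∑≤-zero b (λ j j≤b → onlyIf-false (revBy a p i * revBy b q j) (λ t →
     ℕP.<⇒≱ a+b<n (subst (ℕ._≤ a ℕ.+ b) (ℕP.≡ᵇ⇒≡ _ n t) (ℕP.+-mono-≤ i≤a j≤b))))))))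

tMinus1 : Poly
tMinus1 zero          = -1ℤ
tMinus1 (suc zero)    = 1ℤ
tMinus1 (suc (suc _)) = 0ℤ

tMinus1-degree : DegLe tMinus1 1
tMinus1-degree (suc zero)    (s≤s ())
tMinus1-degree (suc (suc _)) _ = refl

tMinus1*≗tMinus1*ₚ : ∀ p → tMinus1* p ≗ (tMinus1 *ₚ p)
tMinus1*≗tMinus1*ₚ p zero    = sym (trans (ℤP.+-identityʳ (-1ℤ * p 0)) (ℤP.-1*i≡-i (p 0)))
tMinus1*≗tMinus1*ₚ p (suc m) = sym (begin
  (tMinus1 *ₚ p) (suc m)             ≡⟨ ∑≤-extend (suc m) f (s≤s z≤n) higher-terms ⟩
  -1ℤ * p (suc m) + (1ℤ * p m + 0ℤ)  ≡⟨ cong₂ _+_ (ℤP.-1*i≡-i (p (suc m)))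
                                                 (trans (ℤP.+-identityʳ _) (ℤP.*-identityˡ (p m))) ⟩
  - p (suc m) + p m                  ≡⟨ ℤP.+-comm (- p (suc m)) (p m) ⟩
  p m - p (suc m)                    ∎)
  where
  open ≡-Reasoning
  f : ℕ → ℤ
  f i = tMinus1 i * p (suc m ∸ i)
  higher-terms : ∀ i → 1 ℕ.< i → i ℕ.≤ suc m → f i ≡ 0ℤ
  higher-terms (suc zero)    (s≤s ()) _
  higher-terms i@(suc (suc _)) _        _ = ℤP.*-zeroˡ (p (suc m ∸ i))

tMinus1*-*ₚ : ∀ p q → tMinus1* (p *ₚ q) ≗ (tMinus1* p *ₚ q)
tMinus1*-*ₚ p q n = trans (tMinus1*≗tMinus1*ₚ (p *ₚ q) n)
  (trans (sym (*ₚ-assoc tMinus1 p q n)) (*ₚ-congˡ q (λ i → sym (tMinus1*≗tMinus1*ₚ p i)) n))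

tMinus1*-∑ : ∀ {A : Set} (xs : List A) (P : A → Poly) →
             tMinus1* (λ m → ∑ xs (λ a → P a m)) ≗ (λ n → ∑ xs (λ a → tMinus1* (P a) n))
tMinus1*-∑ xs P zero    = sym (∑-neg xs (λ a → P a 0))
tMinus1*-∑ xs P (suc n) = sym (trans (∑-+ xs (λ a → P a n) (λ a → - P a (suc n)))
                                     (cong (∑ xs (λ a → P a n) +_) (∑-neg xs (λ a → P a (suc n)))))

tMinus1*-onlyIf : ∀ b p → tMinus1* (λ m → onlyIf b (p m)) ≗ (λ n → onlyIf b (tMinus1* p n))
tMinus1*-onlyIf true  p n       = refl
tMinus1*-onlyIf false p zero    = refl
tMinus1*-onlyIf false p (suc n) = refl

tMinus1*-distrib-sub : ∀ p q → tMinus1* (λ m → p m - q m) ≗ (λ n → tMinus1* p n - tMinus1* q n)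
tMinus1*-distrib-sub p q zero    = ℤP.neg-distrib-+ (p 0) (- q 0)
tMinus1*-distrib-sub p q (suc n) = [a-b]-[c-d]≡[a-c]-[b-d] (p n) (q n) (p (suc n)) (q (suc n))
  where
  [a-b]-[c-d]≡[a-c]-[b-d] : ∀ a b c d → (a - b) - (c - d) ≡ (a - c) - (b - d)
  [a-b]-[c-d]≡[a-c]-[b-d] = solve-∀

DegLt : Poly → ℕ → Set
DegLt p a = ∀ n → a ℕ.≤ n → p n ≡ 0ℤ

DegLt-*ₚ : ∀ {p q a b} → DegLt p a → DegLe q b → DegLt (p *ₚ q) (a ℕ.+ b)
DegLt-*ₚ {p} {q} {a} {b} p<a q≤b n a+b≤n = ∑≤-zero n term-zero
  where
  term-zero : ∀ i → i ℕ.≤ n → p i * q (n ∸ i) ≡ 0ℤ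
  term-zero i i≤n with ℕP.≤-<-connex a i
  ... | inj₁ a≤i = cong (_* q (n ∸ i)) (p<a i a≤i)
  ... | inj₂ i<a = trans (cong (p i *_) (q≤b (n ∸ i) b<n∸i)) (ℤP.*-zeroʳ (p i))
    where
    b<n∸i : b ℕ.< n ∸ i
    b<n∸i = subst (ℕ._≤ n ∸ i) (ℕP.m+n∸m≡n i (suc b)) (ℕP.∸-monoˡ-≤ i i+1+b≤n)
      where
      i+1+b≤n : i ℕ.+ suc b ℕ.≤ n
      i+1+b≤n = ℕP.≤-trans (subst (ℕ._≤ a ℕ.+ b) (sym (ℕP.+-suc i b)) (ℕP.+-monoˡ-≤ b i<a)) a+b≤n

-- The coefficients of p are constant from d on, and finite support makes them 0.
DegLt-cancel-tMinus1* : ∀ {p d} → IsPoly p → DegLe (tMinus1* p) d → DegLt p d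
DegLt-cancel-tMinus1* {p} {d} (N , p<N) tp≤d n d≤n = trans (constant N) (p<N (n ℕ.+ N) (ℕP.m≤n+m N n))
  where
  constant : ∀ k → p n ≡ p (n ℕ.+ k)
  constant zero    = cong p (sym (ℕP.+-identityʳ n))
  constant (suc k) = trans (constant k)
    (trans (ℤP.i-j≡0⇒i≡j _ _ (tp≤d (suc (n ℕ.+ k)) (s≤s (ℕP.≤-trans d≤n (ℕP.m≤m+n n k)))))
           (cong p (sym (ℕP.+-suc n k))))

revBy-tMinus1* : ∀ {p} d → DegLe p d → revBy (suc d) (tMinus1* p) ≗ (λ n → - tMinus1* (revBy d p) n)
revBy-tMinus1* {p} d p≤d n = begin
  revBy (suc d) (tMinus1* p) n                   ≡⟨ revBy-cong (suc d) (tMinus1*≗tMinus1*ₚ p) n ⟩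
  revBy (1 ℕ.+ d) (tMinus1 *ₚ p) n               ≡⟨ revBy-*ₚ 1 d tMinus1 p tMinus1-degree p≤d n ⟩
  (revBy 1 tMinus1 *ₚ revBy d p) n               ≡⟨ *ₚ-congˡ (revBy d p) reversed n ⟩
  ((λ m → -1ℤ * tMinus1 m) *ₚ revBy d p) n       ≡⟨ *ₚ-scalˡ -1ℤ tMinus1 (revBy d p) n ⟩
  -1ℤ * (tMinus1 *ₚ revBy d p) n                 ≡⟨ ℤP.-1*i≡-i _ ⟩
  - (tMinus1 *ₚ revBy d p) n                     ≡⟨ cong -_ (sym (tMinus1*≗tMinus1*ₚ (revBy d p) n)) ⟩
  - tMinus1* (revBy d p) n                       ∎
  where
  open ≡-Reasoning
  reversed : revBy 1 tMinus1 ≗ (λ m → -1ℤ * tMinus1 m)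
  reversed zero          = refl
  reversed (suc zero)    = refl
  reversed (suc (suc _)) = refl

-- rev_R ((t - 1) L) = - (t - 1) rev_{R-1} L, so by antisymmetry L - rev_{R-1} L is a polynomial killed by t - 1.
palindromic : ∀ {L} R → DegLt L R → (∀ n → revBy R (tMinus1* L) n ≡ - tMinus1* L n) → L ≗ revBy (R ∸ 1) L
palindromic {L} zero    L<0 _    n = trans (L<0 n z≤n) (sym (onlyIf-zero (n ≤ᵇ 0) (λ _ → L<0 (0 ∸ n) z≤n)))
palindromic {L} (suc D) L≤D anti n =
  ℤP.i-j≡0⇒i≡j (L n) (L' n) (DegLt-cancel-tMinus1* {d = 0} difference-poly annihilated n z≤n)
  where
  open ≡-Reasoning
  L' : Poly
  L' = revBy D L
  difference : Poly
  difference m = L m - L' m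
  difference-poly : IsPoly difference
  difference-poly = suc D , λ m D<m → cong₂ _-_ (L≤D m D<m) (revBy-> L D<m)
  same-image : ∀ m → tMinus1* L' m ≡ tMinus1* L m
  same-image m = begin
    tMinus1* L' m                      ≡⟨ sym (ℤP.neg-involutive _) ⟩
    - - tMinus1* L' m                  ≡⟨ cong -_ (sym (revBy-tMinus1* D L≤D m)) ⟩
    - revBy (suc D) (tMinus1* L) m     ≡⟨ cong -_ (anti m) ⟩
    - - tMinus1* L m                   ≡⟨ ℤP.neg-involutive _ ⟩
    tMinus1* L m                       ∎
  annihilated : DegLe (tMinus1* difference) 0
  annihilated m _ = begin
    tMinus1* difference m              ≡⟨ tMinus1*-distrib-sub L L' m ⟩
    tMinus1* L m - tMinus1* L' m       ≡⟨ cong (λ x → tMinus1* L m - x) (same-image m) ⟩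
    tMinus1* L m - tMinus1* L m        ≡⟨ ℤP.+-inverseʳ (tMinus1* L m) ⟩
    0ℤ                                 ∎

-- Incidence algebras

module IncidenceAlgebra (B : FinPoset) where
  open FinPoset B
  open Incidence _≤_ _≤?_ elems

  leb-sound : ∀ {x y} → T (leb x y) → x ≤ y
  leb-sound {x} {y} t with x ≤? y
  ... | yes x≤y = x≤y

  leb-complete : ∀ {x y} → x ≤ y → T (leb x y)
  leb-complete {x} {y} x≤y with x ≤? y
  ... | yes _   = tt
  ... | no  x≰y = x≰y x≤y

  eqb-sound : ∀ {x y} → T (eqb x y) → x ≡ y
  eqb-sound t = let x≤y , y≤x = Equivalence.to T-∧ t in ≤-antisym _ _ (leb-sound x≤y) (leb-sound y≤x)

  eqb-refl : ∀ x → T (eqb x x)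
  eqb-refl x = Equivalence.from T-∧ (leb-complete (≤-refl x) , leb-complete (≤-refl x))

  _≟_ : DecidableEquality Carrier
  x ≟ y = map′ eqb-sound (λ { refl → eqb-refl x }) (T? (eqb x y))

  between : Carrier → Carrier → Carrier → Bool
  between z z' w = leb z w ∧ leb w z'

  between⇔ : ∀ {z z' w} → T (between z z' w) ⇔ (z ≤ w × w ≤ z')
  between⇔ = mk⇔ (λ t → let z≤w , w≤z' = Equivalence.to T-∧ t in leb-sound z≤w , leb-sound w≤z')
                 (λ (z≤w , w≤z') → Equivalence.from T-∧ (leb-complete z≤w , leb-complete w≤z'))

  between² : ∀ {a b c d e f} → T (between a b c ∧ between d e f) ⇔ ((a ≤ c × c ≤ b) × (d ≤ f × f ≤ e))
  between² = ⇔.trans T-∧ (between⇔ ×-⇔ between⇔)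

  between-swap : ∀ z z' v w → (between z z' w ∧ between z w v) ≡ (between z z' v ∧ between v z' w)
  between-swap z z' v w = T-⇔⇒≡ (mk⇔
    (λ t → let (_ , w≤z') , (z≤v , v≤w) = Equivalence.to between² t
           in Equivalence.from between² ((z≤v , ≤-trans v w z' v≤w w≤z') , (v≤w , w≤z')))
    (λ t → let (z≤v , _) , (v≤w , w≤z') = Equivalence.to between² t
           in Equivalence.from between² ((≤-trans z v w z≤v v≤w , w≤z') , (z≤v , v≤w))))

  ·-single : ∀ p q {z z' n} w₀ → z ≤ w₀ → w₀ ≤ z' →
         (∀ w → w ≢ w₀ → z ≤ w → w ≤ z' → (p z w *ₚ q w z') n ≡ 0ℤ) →
         (p · q) z z' n ≡ (p z w₀ *ₚ q w₀ z') n
  ·-single p q {z} {z'} {n} w₀ z≤w₀ w₀≤z' others =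
    trans (∑-single elems unique (complete w₀) (λ w → onlyIf (between z z' w) ((p z w *ₚ q w z') n))
             (λ w _ w≢w₀ → onlyIf-zero (between z z' w) (λ t →
                let z≤w , w≤z' = Equivalence.to between⇔ t in others w w≢w₀ z≤w w≤z')))
          (onlyIf-true _ (Equivalence.from between⇔ (z≤w₀ , w₀≤z')))

  ·-vanish : ∀ p q {z z' n} → (∀ w → z ≤ w → w ≤ z' → (p z w *ₚ q w z') n ≡ 0ℤ) → (p · q) z z' n ≡ 0ℤ
  ·-vanish p q {z} {z'} {n} zero-terms = ∑-zero elems (λ w _ → onlyIf-zero (between z z' w) (λ t →
    let z≤w , w≤z' = Equivalence.to between⇔ t in zero-terms w z≤w w≤z'))

  -- A record, so that p and q can be inferred from a proof of p ≃ q.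
  record _≃_ (p q : Inc) : Set where
    constructor ≈⇒≃
    field ≃⇒≈ : p ≈ q
  open _≃_ public

  ≃-setoid : Setoid 0ℓ 0ℓ
  ≃-setoid = record
    { Carrier       = Inc
    ; _≈_           = _≃_
    ; isEquivalence = record
      { refl  = ≈⇒≃ (λ _ _ _ _ → refl)
      ; sym   = λ (≈⇒≃ p≈q) → ≈⇒≃ (λ z z' z≤z' n → sym (p≈q z z' z≤z' n))
      ; trans = λ (≈⇒≃ p≈q) (≈⇒≃ q≈s) →
                  ≈⇒≃ (λ z z' z≤z' n → trans (p≈q z z' z≤z' n) (q≈s z z' z≤z' n))
      }
    }

  ·-assoc : ∀ p q s → ((p · q) · s) ≃ (p · (q · s))
  ·-assoc p q s = ≈⇒≃ λ z z' _ n →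
    let term : Carrier → Carrier → ℤ
        term v w = (p z v *ₚ (q v w *ₚ s w z')) n
    in begin
    ∑ elems (λ w → onlyIf (between z z' w) (((p · q) z w *ₚ s w z') n))
      ≡⟨ ∑-cong elems (λ w _ → cong (onlyIf (between z z' w)) (trans
           (*ₚ-∑ˡ elems (λ v m → onlyIf (between z w v) ((p z v *ₚ q v w) m)) (s w z') n)
           (∑-cong elems (λ v _ → trans (*ₚ-onlyIfˡ (between z w v) (p z v *ₚ q v w) (s w z') n)
                                        (cong (onlyIf (between z w v)) (*ₚ-assoc (p z v) (q v w) (s w z') n)))))) ⟩
    ∑ elems (λ w → onlyIf (between z z' w) (∑ elems (λ v → onlyIf (between z w v) (term v w))))
      ≡⟨ ∑-cong elems (λ w _ → trans (onlyIf-∑ (between z z' w) elems _)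
                                     (∑-cong elems (λ v _ → onlyIf-∧ (between z z' w) (between z w v) (term v w)))) ⟩
    ∑ elems (λ w → ∑ elems (λ v → onlyIf (between z z' w ∧ between z w v) (term v w)))
      ≡⟨ ∑-cong elems (λ w _ → ∑-cong elems (λ v _ → cong (λ b → onlyIf b (term v w)) (between-swap z z' v w))) ⟩
    ∑ elems (λ w → ∑ elems (λ v → onlyIf (between z z' v ∧ between v z' w) (term v w)))
      ≡⟨ ∑-swap elems elems (λ w v → onlyIf (between z z' v ∧ between v z' w) (term v w)) ⟩
    ∑ elems (λ v → ∑ elems (λ w → onlyIf (between z z' v ∧ between v z' w) (term v w)))
      ≡⟨ ∑-cong elems (λ v _ → sym (trans (onlyIf-∑ (between z z' v) elems _)
                                          (∑-cong elems (λ w _ → onlyIf-∧ (between z z' v) (between v z' w) (term v w))))) ⟩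
    ∑ elems (λ v → onlyIf (between z z' v) (∑ elems (λ w → onlyIf (between v z' w) (term v w))))
      ≡⟨ ∑-cong elems (λ v _ → cong (onlyIf (between z z' v)) (sym (trans
           (*ₚ-∑ʳ elems (p z v) (λ w m → onlyIf (between v z' w) ((q v w *ₚ s w z') m)) n)
           (∑-cong elems (λ w _ → *ₚ-onlyIfʳ (between v z' w) (p z v) (q v w *ₚ s w z') n))))) ⟩
    ∑ elems (λ v → onlyIf (between z z' v) ((p z v *ₚ (q · s) v z') n))
      ∎
    where open ≡-Reasoning

  open Setoid ≃-setoid public using () renaming (refl to ≃-refl; sym to ≃-sym; trans to ≃-trans)

  ·-cong : ∀ {p p' q q'} → p ≃ p' → q ≃ q' → (p · q) ≃ (p' · q')
  ·-cong (≈⇒≃ p≈p') (≈⇒≃ q≈q') = ≈⇒≃ λ z z' _ n →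
    ∑-cong elems (λ w _ → onlyIf-cong (between z z' w) (λ t →
      let z≤w , w≤z' = Equivalence.to between⇔ t in *ₚ-cong (p≈p' z w z≤w) (q≈q' w z' w≤z') n))

  ·-congˡ : ∀ {p p'} q → p ≃ p' → (p · q) ≃ (p' · q)
  ·-congˡ q p≃p' = ·-cong p≃p' (≃-refl {q})

  ·-congʳ : ∀ p {q q'} → q ≃ q' → (p · q) ≃ (p · q')
  ·-congʳ p q≃q' = ·-cong (≃-refl {p}) q≃q'

  δ-diagonal : ∀ z → δ z z ≗ 1ₚ
  δ-diagonal z m with eqb z z | eqb-refl z
  ... | true | _ = refl

  δ-off-diagonal : ∀ {z w} → z ≢ w → δ z w ≗ 0ₚ
  δ-off-diagonal {z} {w} z≢w m with eqb z w in eq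
  ... | true  = ⊥-elim (z≢w (eqb-sound (subst T (sym eq) tt)))
  ... | false = refl

  ·-identityˡ : ∀ p → (δ · p) ≃ p
  ·-identityˡ p = ≈⇒≃ λ z z' z≤z' n →
    trans (·-single δ p z (≤-refl z) z≤z'
             (λ w w≢z _ _ → *ₚ-zeroˡ (p w z') (δ-off-diagonal (λ z≡w → w≢z (sym z≡w))) n))
          (trans (*ₚ-congˡ (p z z') (δ-diagonal z) n) (*ₚ-identityˡ (p z z') n))

  ·-identityʳ : ∀ p → (p · δ) ≃ p
  ·-identityʳ p = ≈⇒≃ λ z z' z≤z' n →
    trans (·-single p δ z' z≤z' (≤-refl z') (λ w w≢z' _ _ → *ₚ-zeroʳ (p z w) (δ-off-diagonal w≢z') n))
          (trans (*ₚ-congʳ (p z z') (δ-diagonal z') n) (*ₚ-identityʳ (p z z') n))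

  neg : Inc → Inc
  neg p z z' m = -1ℤ * p z z' m

  neg-cong : ∀ {p q} → p ≃ q → neg p ≃ neg q
  neg-cong (≈⇒≃ p≈q) = ≈⇒≃ λ z z' z≤z' n → cong (-1ℤ *_) (p≈q z z' z≤z' n)

  ·-negˡ : ∀ p q → (neg p · q) ≃ neg (p · q)
  ·-negˡ p q = ≈⇒≃ λ z z' _ n → trans
    (∑-cong elems (λ w _ → trans (cong (onlyIf (between z z' w)) (*ₚ-scalˡ -1ℤ (p z w) (q w z') n))
                                 (sym (onlyIf-*ˡ (between z z' w) -1ℤ _))))
    (∑-*ˡ elems -1ℤ (λ w → onlyIf (between z z' w) ((p z w *ₚ q w z') n)))

  ·-negʳ : ∀ p q → (p · neg q) ≃ neg (p · q)
  ·-negʳ p q = ≈⇒≃ λ z z' _ n → trans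
    (∑-cong elems (λ w _ → trans (cong (onlyIf (between z z' w)) (*ₚ-scalʳ -1ℤ (p z w) (q w z') n))
                                 (sym (onlyIf-*ˡ (between z z' w) -1ℤ _))))
    (∑-*ˡ elems -1ℤ (λ w → onlyIf (between z z' w) ((p z w *ₚ q w z') n)))

  tMinus1·-· : ∀ p q → (tMinus1· (p · q)) ≃ ((tMinus1· p) · q)
  tMinus1·-· p q = ≈⇒≃ λ z z' _ n → trans
    (tMinus1*-∑ elems (λ w m → onlyIf (between z z' w) ((p z w *ₚ q w z') m)) n)
    (∑-cong elems (λ w _ → trans (tMinus1*-onlyIf (between z z' w) (p z w *ₚ q w z') n)
                                 (cong (onlyIf (between z z' w)) (tMinus1*-*ₚ (p z w) (q w z') n))))

  module Ranked (r : Carrier → Carrier → ℕ) (r-weak : IsWeakRank r) where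

    r-additive : ∀ z w z' → z ≤ w → w ≤ z' → r z z' ≡ r z w ℕ.+ r w z'
    r-additive = proj₂ r-weak

    r-refl : ∀ z → r z z ≡ 0
    r-refl z = sym (ℕP.+-cancelˡ-≡ (r z z) 0 (r z z)
                     (trans (ℕP.+-identityʳ (r z z)) (r-additive z z z (≤-refl z) (≤-refl z))))

    BelowRank : Inc → Set
    BelowRank p = ∀ z z' → z ≤ z' → DegLt (p z z') (r z z')

    BelowRank-· : ∀ {p q} → BelowRank p → In𝓘 r q → BelowRank (p · q)
    BelowRank-· {p} {q} p< q𝓘 z z' _ n r≤n = ·-vanish p q λ w z≤w w≤z' →
      DegLt-*ₚ (p< z w z≤w) (q𝓘 w z' w≤z') n (subst (ℕ._≤ n) (r-additive z w z' z≤w w≤z') r≤n)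

    In𝓘-· : ∀ {p q} → In𝓘 r p → In𝓘 r q → In𝓘 r (p · q)
    In𝓘-· {p} {q} p𝓘 q𝓘 z z' _ n r<n = ·-vanish p q λ w z≤w w≤z' →
      DegLt-*ₚ (p𝓘 z w z≤w) (q𝓘 w z' w≤z') n (subst (ℕ._< n) (r-additive z w z' z≤w w≤z') r<n)

    In𝓘-resp-≃ : ∀ {p q} → p ≃ q → In𝓘 r q → In𝓘 r p
    In𝓘-resp-≃ (≈⇒≃ p≈q) q𝓘 z z' z≤z' n r<n = trans (p≈q z z' z≤z' n) (q𝓘 z z' z≤z' n r<n)

    BelowRank-cancel-tMinus1 : ∀ {h} → IsPolyValued h → In𝓘 r (tMinus1· h) → BelowRank h
    BelowRank-cancel-tMinus1 h-poly th𝓘 z z' z≤z' = DegLt-cancel-tMinus1* (h-poly z z' z≤z') (th𝓘 z z' z≤z')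

    rev-cong : ∀ {p q} → p ≃ q → rev r p ≃ rev r q
    rev-cong (≈⇒≃ p≈q) = ≈⇒≃ λ z z' z≤z' → revBy-cong (r z z') (p≈q z z' z≤z')

    rev-· : ∀ {p q} → In𝓘 r p → In𝓘 r q → rev r (p · q) ≃ (rev r p · rev r q)
    rev-· {p} {q} p𝓘 q𝓘 = ≈⇒≃ λ z z' _ n → trans
      (revBy-∑ (r z z') elems (λ w m → onlyIf (between z z' w) ((p z w *ₚ q w z') m)) n)
      (∑-cong elems (λ w _ → trans (revBy-onlyIf (r z z') (between z z' w) (p z w *ₚ q w z') n)
        (onlyIf-cong (between z z' w) (λ t → let z≤w , w≤z' = Equivalence.to between⇔ t in trans
          (cong (λ d → revBy d (p z w *ₚ q w z') n) (r-additive z w z' z≤w w≤z'))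
          (revBy-*ₚ (r z w) (r w z') (p z w) (q w z') (p𝓘 z w z≤w) (q𝓘 w z' w≤z') n)))))

    rev-δ : rev r δ ≃ δ
    rev-δ = ≈⇒≃ λ z z' _ n → diagonal-or-not z z' n
      where
      diagonal-or-not : ∀ z z' n → rev r δ z z' n ≡ δ z z' n
      diagonal-or-not z z' n with z ≟ z'
      ... | no z≢z' = trans (revBy-cong (r z z') (δ-off-diagonal z≢z') n)
                            (trans (revBy-0ₚ (r z z') n) (sym (δ-off-diagonal z≢z' n)))
      ... | yes refl rewrite r-refl z = trans (revBy-cong 0 (δ-diagonal z) n) (trans (revBy-1ₚ n) (sym (δ-diagonal z n)))
        where
        revBy-1ₚ : revBy 0 1ₚ ≗ 1ₚ
        revBy-1ₚ zero    = refl
        revBy-1ₚ (suc _) = refl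

    -- Induction on r(z,z'): above degree r(z,z'), only the term g(z,z) gi(z,z') of (g · gi)(z,z') = δ(z,z') survives.
    In𝓘-inverse : ∀ {g gi} → In𝓘 r g → InU g → IsInverse g gi → In𝓘 r gi
    In𝓘-inverse {g} {gi} g𝓘 g-unit (g·gi≈δ , gi·g≈δ) z z' z≤z' = <-rec P bound (r z z') z z' z≤z' refl
      where
      open ≡-Reasoning
      P : ℕ → Set
      P k = ∀ z z' → z ≤ z' → r z z' ≡ k → DegLe (gi z z') (r z z')
      bound : ∀ k → (∀ {k'} → k' ℕ.< k → P k') → P k
      bound _ smaller z z' z≤z' refl n r<n with z ≟ z'
      ... | yes refl = begin
        gi z z n             ≡⟨ sym (*ₚ-identityʳ (gi z z) n) ⟩
        (gi z z *ₚ 1ₚ) n     ≡⟨ sym (*ₚ-congʳ (gi z z) (g-unit z) n) ⟩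
        (gi z z *ₚ g z z) n  ≡⟨ sym (·-single gi g z (≤-refl z) (≤-refl z)
                                    (λ w w≢z z≤w w≤z → ⊥-elim (w≢z (≤-antisym w z w≤z z≤w)))) ⟩
        (gi · g) z z n       ≡⟨ gi·g≈δ z z z≤z' n ⟩
        δ z z n              ≡⟨ δ-diagonal z n ⟩
        1ₚ n                 ≡⟨ 1ₚ-positive (ℕP.≤-trans (s≤s z≤n) r<n) ⟩
        0ℤ                   ∎
      ... | no z≢z' = begin
        gi z z' n            ≡⟨ sym (*ₚ-identityˡ (gi z z') n) ⟩
        (1ₚ *ₚ gi z z') n    ≡⟨ sym (*ₚ-congˡ (gi z z') (g-unit z) n) ⟩
        (g z z *ₚ gi z z') n ≡⟨ sym (·-single g gi z (≤-refl z) z≤z' others) ⟩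
        (g · gi) z z' n      ≡⟨ g·gi≈δ z z' z≤z' n ⟩
        δ z z' n             ≡⟨ δ-off-diagonal z≢z' n ⟩
        0ℤ                   ∎
        where
        others : ∀ w → w ≢ z → z ≤ w → w ≤ z' → (g z w *ₚ gi w z') n ≡ 0ℤ
        others w w≢z z≤w w≤z' =
          DegLt-*ₚ (g𝓘 z w z≤w) (smaller r-decreases w z' w≤z' refl) n (subst (ℕ._< n) split r<n)
          where
          split : r z z' ≡ r z w ℕ.+ r w z'
          split = r-additive z w z' z≤w w≤z'
          r-decreases : r w z' ℕ.< r z z'
          r-decreases = subst (r w z' ℕ.<_) (sym split)
                              (ℕP.m<n+m (r w z') (proj₁ r-weak z w (z≤w , λ z≡w → w≢z (sym z≡w))))

    module Kernel {κ g gi : Inc} (g-KLS : IsLeftKLS r κ g) (g-inverse : IsInverse g gi) where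
      open import Relation.Binary.Reasoning.Setoid ≃-setoid

      g𝓘 : In𝓘 r g
      g𝓘 = proj₁ (proj₁ g-KLS)

      gi𝓘 : In𝓘 r gi
      gi𝓘 = In𝓘-inverse g𝓘 (proj₁ (proj₂ g-KLS)) g-inverse

      g-rev : rev r g ≃ (g · κ)
      g-rev = ≈⇒≃ (proj₂ (proj₂ g-KLS))

      κ·rev-inverse : (κ · rev r gi) ≃ gi
      κ·rev-inverse = begin
        κ · rev r gi               ≈⟨ ≃-sym (·-identityˡ _) ⟩
        δ · (κ · rev r gi)         ≈⟨ ·-congˡ (κ · rev r gi) (≃-sym (≈⇒≃ (proj₂ g-inverse))) ⟩
        (gi · g) · (κ · rev r gi)  ≈⟨ ·-assoc gi g (κ · rev r gi) ⟩
        gi · (g · (κ · rev r gi))  ≈⟨ ·-congʳ gi (≃-sym (·-assoc g κ (rev r gi))) ⟩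
        gi · ((g · κ) · rev r gi)  ≈⟨ ·-congʳ gi (·-congˡ (rev r gi) (≃-sym g-rev)) ⟩
        gi · (rev r g · rev r gi)  ≈⟨ ·-congʳ gi (≃-sym (rev-· g𝓘 gi𝓘)) ⟩
        gi · rev r (g · gi)        ≈⟨ ·-congʳ gi (rev-cong (≈⇒≃ (proj₁ g-inverse))) ⟩
        gi · rev r δ               ≈⟨ ·-congʳ gi rev-δ ⟩
        gi · δ                     ≈⟨ ·-identityʳ gi ⟩
        gi                         ∎

      rev-conjugate : ∀ {k} → In𝓘 r k → (κ · rev r k) ≃ neg (k · κ) → rev r ((g · k) · gi) ≃ neg ((g · k) · gi)
      rev-conjugate {k} k𝓘 κ·rev-k = begin
        rev r ((g · k) · gi)             ≈⟨ rev-· (In𝓘-· g𝓘 k𝓘) gi𝓘 ⟩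
        rev r (g · k) · rev r gi         ≈⟨ ·-congˡ (rev r gi) (rev-· g𝓘 k𝓘) ⟩
        (rev r g · rev r k) · rev r gi   ≈⟨ ·-congˡ (rev r gi) (·-congˡ (rev r k) g-rev) ⟩
        ((g · κ) · rev r k) · rev r gi   ≈⟨ ·-congˡ (rev r gi) (·-assoc g κ (rev r k)) ⟩
        (g · (κ · rev r k)) · rev r gi   ≈⟨ ·-congˡ (rev r gi) (·-congʳ g κ·rev-k) ⟩
        (g · neg (k · κ)) · rev r gi     ≈⟨ ·-congˡ (rev r gi) (·-negʳ g (k · κ)) ⟩
        neg (g · (k · κ)) · rev r gi     ≈⟨ ·-negˡ (g · (k · κ)) (rev r gi) ⟩
        neg ((g · (k · κ)) · rev r gi)   ≈⟨ neg-cong (·-congˡ (rev r gi) (≃-sym (·-assoc g k κ))) ⟩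
        neg (((g · k) · κ) · rev r gi)   ≈⟨ neg-cong (·-assoc (g · k) κ (rev r gi)) ⟩
        neg ((g · k) · (κ · rev r gi))   ≈⟨ neg-cong (·-congʳ (g · k) κ·rev-inverse) ⟩
        neg ((g · k) · gi)               ∎

-- The poset Γ of a strong formal subdivision

sgn-suc : ∀ a b → sgn (a ℕ.+ suc b) ≡ - sgn (b ℕ.+ a)
sgn-suc a b = trans (cong sgn (ℕP.+-suc a b)) (cong (λ m → - sgn m) (ℕP.+-comm a b))

module StrongFormalSubdivision (X Y : FinPoset) (ρX : FinPoset.Carrier X → ℕ) (ρY : FinPoset.Carrier Y → ℕ)
  (σ : FinPoset.Carrier X → FinPoset.Carrier Y) (σ-strong : Subdivision.IsStrongFormalSubdivision X Y ρX ρY σ) where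
  private
    module X = FinPoset X
    module Y = FinPoset Y
    module AY where
      open Incidence Y._≤_ Y._≤?_ Y.elems public using (eqb)
      open IncidenceAlgebra Y public
  open Subdivision X Y using (module Γ)
  open Γ σ

  subdivision-sum : ∀ x y → σ x Y.≤ y →
                    ∑ X.elems (λ x' → onlyIf (does (x X.≤? x') ∧ AY.eqb (σ x') y) (sgn (ρY y ℕ.+ ρX x'))) ≡ 1ℤ
  subdivision-sum = proj₂ (proj₂ (proj₂ (proj₂ σ-strong)))

  Γ-complete : ∀ z → z ∈ elems
  Γ-complete (inj₁ x) = ∈-++⁺ˡ (∈-map⁺ inj₁ (X.complete x))
  Γ-complete (inj₂ y) = ∈-++⁺ʳ (map inj₁ X.elems) (∈-map⁺ inj₂ (Y.complete y))

  Γ-unique : Unique elems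
  Γ-unique = UniqueP.++⁺ (UniqueP.map⁺ inj₁-injective X.unique) (UniqueP.map⁺ inj₂-injective Y.unique) disjoint
    where
    disjoint : ∀ {z} → ¬ (z ∈ map inj₁ X.elems × z ∈ map inj₂ Y.elems)
    disjoint (z∈X , z∈Y) with ∈-map⁻ inj₁ z∈X | ∈-map⁻ inj₂ z∈Y
    ... | _ , _ , refl | _ , _ , ()

  Γ-refl : ∀ z → z ≤ z
  Γ-refl (inj₁ x) = X.≤-refl x
  Γ-refl (inj₂ y) = Y.≤-refl y

  Γ-trans : ∀ a b c → a ≤ b → b ≤ c → a ≤ c
  Γ-trans (inj₁ a) (inj₁ b) (inj₁ c) a≤b b≤c = X.≤-trans a b c a≤b b≤c
  Γ-trans (inj₁ a) (inj₁ b) (inj₂ c) a≤b b≤c = Y.≤-trans (σ a) (σ b) c (proj₁ σ-strong a b a≤b) b≤c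
  Γ-trans (inj₁ a) (inj₂ b) (inj₂ c) a≤b b≤c = Y.≤-trans (σ a) b c a≤b b≤c
  Γ-trans (inj₂ a) (inj₂ b) (inj₂ c) a≤b b≤c = Y.≤-trans a b c a≤b b≤c

  Γ-antisym : ∀ a b → a ≤ b → b ≤ a → a ≡ b
  Γ-antisym (inj₁ a) (inj₁ b) a≤b b≤a = cong inj₁ (X.≤-antisym a b a≤b b≤a)
  Γ-antisym (inj₂ a) (inj₂ b) a≤b b≤a = cong inj₂ (Y.≤-antisym a b a≤b b≤a)

  Γ-poset : FinPoset
  Γ-poset = record
    { Carrier = Carrier ; _≤_ = _≤_ ; _≤?_ = _≤?_ ; elems = elems ; complete = Γ-complete ; unique = Γ-unique
    ; ≤-refl = Γ-refl ; ≤-trans = Γ-trans ; ≤-antisym = Γ-antisym }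

  open IncidenceAlgebra Γ-poset public

  ∑-Γ : ∀ f → ∑ elems f ≡ ∑ X.elems (λ x → f (inj₁ x)) + ∑ Y.elems (λ y → f (inj₂ y))
  ∑-Γ f = trans (∑-++ (map inj₁ X.elems) (map inj₂ Y.elems) f)
                (cong₂ _+_ (∑-map X.elems inj₁ f) (∑-map Y.elems inj₂ f))

  restrictXY-on : ∀ p {x y} → σ x ≡ y → restrictXY p (inj₁ x) (inj₂ y) ≡ p (inj₁ x) (inj₂ y)
  restrictXY-on p {x} refl with AY.eqb (σ x) (σ x) | AY.eqb-refl (σ x)
  ... | true | _ = refl

  restrictXY-off : ∀ p {x y} → σ x ≢ y → restrictXY p (inj₁ x) (inj₂ y) ≡ 0ₚ
  restrictXY-off p {x} {y} σx≢y with AY.eqb (σ x) y in eq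
  ... | true  = ⊥-elim (σx≢y (AY.eqb-sound (subst T (sym eq) tt)))
  ... | false = refl

  restrictXY-In𝓘 : ∀ r {p} → In𝓘 r p → In𝓘 r (restrictXY p)
  restrictXY-In𝓘 r {p} p𝓘 (inj₁ x) (inj₂ y) σx≤y n r<n with σ x AY.≟ y
  ... | yes σx≡y = trans (cong (λ P → P n) (restrictXY-on p σx≡y)) (p𝓘 (inj₁ x) (inj₂ y) σx≤y n r<n)
  ... | no  σx≢y = cong (λ P → P n) (restrictXY-off p σx≢y)
  restrictXY-In𝓘 r p𝓘 (inj₁ x) (inj₁ x') _ n _ = refl
  restrictXY-In𝓘 r p𝓘 (inj₂ y) z'        _ n _ = refl

  module _ (r : Carrier → Carrier → ℕ) {κ : Inc} (κ-multiplicative : Multiplicative κ)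
           (κ-alternating : RankAlternating (ρΓ ρX ρY) r κ) where
    private
      k : Inc
      k = restrictXY κ

    restrictXY·κ : ∀ x y → σ x Y.≤ y → ∀ n → (k · κ) (inj₁ x) (inj₂ y) n ≡ κ (inj₁ x) (inj₂ y) n
    restrictXY·κ x y σx≤y n = begin
      (k · κ) (inj₁ x) (inj₂ y) n
        ≡⟨ ·-single k κ {inj₁ x} {inj₂ y} {n} (inj₂ (σ x)) (Y.≤-refl (σ x)) σx≤y others ⟩
      (k (inj₁ x) (inj₂ (σ x)) *ₚ κ (inj₂ (σ x)) (inj₂ y)) n
        ≡⟨ cong (λ P → (P *ₚ κ (inj₂ (σ x)) (inj₂ y)) n) (restrictXY-on κ refl) ⟩
      (κ (inj₁ x) (inj₂ (σ x)) *ₚ κ (inj₂ (σ x)) (inj₂ y)) n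
        ≡⟨ sym (κ-multiplicative (inj₁ x) (inj₂ (σ x)) (inj₂ y) (Y.≤-refl (σ x)) σx≤y n) ⟩
      κ (inj₁ x) (inj₂ y) n
        ∎
      where
      open ≡-Reasoning
      others : ∀ w → w ≢ inj₂ (σ x) → inj₁ x ≤ w → w ≤ inj₂ y → (k (inj₁ x) w *ₚ κ w (inj₂ y)) n ≡ 0ℤ
      others (inj₁ x') _    _ _ = *ₚ-zeroˡ (κ (inj₁ x') (inj₂ y)) (λ _ → refl) n
      others (inj₂ y') w≢σx _ _ = trans
        (cong (λ P → (P *ₚ κ (inj₂ y') (inj₂ y)) n) (restrictXY-off κ (λ σx≡y' → w≢σx (cong inj₂ (sym σx≡y')))))
        (*ₚ-zeroˡ (κ (inj₂ y') (inj₂ y)) (λ _ → refl) n)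

    -- Over x ≤ x' with σ x' = y, rank alternation and multiplicativity turn the sum into
    -- - κ(x,y) times the alternating sum of the strong formal subdivision, which is 1.
    κ·rev-restrictXY-at : ∀ x y → σ x Y.≤ y → ∀ n →
                          (κ · rev r k) (inj₁ x) (inj₂ y) n ≡ - κ (inj₁ x) (inj₂ y) n
    κ·rev-restrictXY-at x y σx≤y n = begin
      (κ · rev r k) (inj₁ x) (inj₂ y) n
        ≡⟨ ∑-Γ F ⟩
      ∑ X.elems (λ x' → F (inj₁ x')) + ∑ Y.elems (λ y' → F (inj₂ y'))
        ≡⟨ cong₂ _+_ (∑-cong X.elems (λ x' _ → term x'))
                     (∑-zero Y.elems (λ y' _ → onlyIf-zero _ (λ _ → Y-term y'))) ⟩
      ∑ X.elems (λ x' → - K * S x') + 0ℤ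
        ≡⟨ ℤP.+-identityʳ _ ⟩
      ∑ X.elems (λ x' → - K * S x')
        ≡⟨ ∑-*ˡ X.elems (- K) S ⟩
      - K * ∑ X.elems S
        ≡⟨ cong (- K *_) (subdivision-sum x y σx≤y) ⟩
      - K * 1ℤ
        ≡⟨ ℤP.*-identityʳ (- K) ⟩
      - K
        ∎
      where
      open ≡-Reasoning
      K : ℤ
      K = κ (inj₁ x) (inj₂ y) n
      F : Carrier → ℤ
      F w = onlyIf (between (inj₁ x) (inj₂ y) w) ((κ (inj₁ x) w *ₚ rev r k w (inj₂ y)) n)
      S : X.Carrier → ℤ
      S x' = onlyIf (does (x X.≤? x') ∧ AY.eqb (σ x') y) (sgn (ρY y ℕ.+ ρX x'))
      Y-term : ∀ y' → (κ (inj₁ x) (inj₂ y') *ₚ rev r k (inj₂ y') (inj₂ y)) n ≡ 0ℤ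
      Y-term y' = *ₚ-zeroʳ (κ (inj₁ x) (inj₂ y')) (revBy-0ₚ (r (inj₂ y') (inj₂ y))) n
      term : ∀ x' → F (inj₁ x') ≡ - K * S x'
      term x' with x X.≤? x'
      ... | no _ = sym (ℤP.*-zeroʳ (- K))
      ... | yes x≤x' with σ x' AY.≟ y
      ...   | no σx'≢y = trans
        (onlyIf-zero _ (λ _ → trans
          (cong (λ P → (κ (inj₁ x) (inj₁ x') *ₚ revBy (r (inj₁ x') (inj₂ y)) P) n) (restrictXY-off κ σx'≢y))
          (*ₚ-zeroʳ (κ (inj₁ x) (inj₁ x')) (revBy-0ₚ (r (inj₁ x') (inj₂ y))) n)))
        (sym (trans (cong (- K *_) (onlyIf-false _ (λ t → σx'≢y (AY.eqb-sound t)))) (ℤP.*-zeroʳ (- K))))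
      ...   | yes σx'≡y = trans (onlyIf-true _ (AY.leb-complete σx'≤y))
        (trans alternating-term
               (cong (- K *_) (sym (onlyIf-true _ (subst (λ v → T (AY.eqb (σ x') v)) σx'≡y (AY.eqb-refl (σ x')))))))
        where
        σx'≤y : σ x' Y.≤ y
        σx'≤y = subst (σ x' Y.≤_) σx'≡y (Y.≤-refl (σ x'))
        s : ℤ
        s = sgn (ρX x' ℕ.+ suc (ρY y))
        -s*K≡-K*s : ∀ s K → - s * K ≡ - K * s
        -s*K≡-K*s = solve-∀
        alternating-term : (κ (inj₁ x) (inj₁ x') *ₚ rev r k (inj₁ x') (inj₂ y)) n ≡ - K * sgn (ρY y ℕ.+ ρX x')
        alternating-term = begin
          (κ (inj₁ x) (inj₁ x') *ₚ revBy (r (inj₁ x') (inj₂ y)) (k (inj₁ x') (inj₂ y))) n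
            ≡⟨ cong (λ P → (κ (inj₁ x) (inj₁ x') *ₚ revBy (r (inj₁ x') (inj₂ y)) P) n) (restrictXY-on κ σx'≡y) ⟩
          (κ (inj₁ x) (inj₁ x') *ₚ rev r κ (inj₁ x') (inj₂ y)) n
            ≡⟨ *ₚ-congʳ (κ (inj₁ x) (inj₁ x')) (κ-alternating (inj₁ x') (inj₂ y) σx'≤y) n ⟩
          (κ (inj₁ x) (inj₁ x') *ₚ (λ m → s * κ (inj₁ x') (inj₂ y) m)) n
            ≡⟨ *ₚ-scalʳ s (κ (inj₁ x) (inj₁ x')) (κ (inj₁ x') (inj₂ y)) n ⟩
          s * (κ (inj₁ x) (inj₁ x') *ₚ κ (inj₁ x') (inj₂ y)) n
            ≡⟨ cong (s *_) (sym (κ-multiplicative (inj₁ x) (inj₁ x') (inj₂ y) x≤x' σx'≤y n)) ⟩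
          s * K
            ≡⟨ cong (_* K) (sgn-suc (ρX x') (ρY y)) ⟩
          - sgn (ρY y ℕ.+ ρX x') * K
            ≡⟨ -s*K≡-K*s (sgn (ρY y ℕ.+ ρX x')) K ⟩
          - K * sgn (ρY y ℕ.+ ρX x') ∎

    κ·rev-restrictXY : (κ · rev r k) ≃ neg (k · κ)
    κ·rev-restrictXY = ≈⇒≃ λ where
      (inj₁ x) (inj₂ y) σx≤y n → trans (κ·rev-restrictXY-at x y σx≤y n)
        (trans (sym (ℤP.-1*i≡-i _)) (cong (-1ℤ *_) (sym (restrictXY·κ x y σx≤y n))))
      (inj₁ x) (inj₁ x') _ n → trans
        (·-vanish κ (rev r k) {inj₁ x} {inj₁ x'} {n} λ
           { (inj₁ w) _ _ → *ₚ-zeroʳ (κ (inj₁ x) (inj₁ w)) (revBy-0ₚ (r (inj₁ w) (inj₁ x'))) n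
           ; (inj₂ _) _ () })
        (sym (cong (-1ℤ *_) (·-vanish k κ {inj₁ x} {inj₁ x'} {n} λ
           { (inj₁ w) _ _ → *ₚ-zeroˡ (κ (inj₁ w) (inj₁ x')) (λ _ → refl) n
           ; (inj₂ _) _ () })))
      (inj₂ y) z' _ n → trans
        (·-vanish κ (rev r k) {inj₂ y} {z'} {n} λ
           { (inj₂ w) _ _ → *ₚ-zeroʳ (κ (inj₂ y) (inj₂ w)) (revBy-0ₚ (r (inj₂ w) z')) n
           ; (inj₁ _) () _ })
        (sym (cong (-1ℤ *_) (·-vanish k κ {inj₂ y} {z'} {n} λ w _ _ → *ₚ-zeroˡ (κ w z') (λ _ → refl) n)))

proposition3p7 :
    (X Y : FinPoset) →
    (ρX : FinPoset.Carrier X → ℕ) → (ρY : FinPoset.Carrier Y → ℕ) →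
    IsLowerEulerian X ρX → IsLowerEulerian Y ρY →
    (σ : FinPoset.Carrier X → FinPoset.Carrier Y) →
    Subdivision.IsStrongFormalSubdivision X Y ρX ρY σ →
    (r : Subdivision.Γ.Carrier X Y σ → Subdivision.Γ.Carrier X Y σ → ℕ) →
    Subdivision.Γ.IsWeakRank X Y σ r →
    (κ : Subdivision.Γ.Inc X Y σ) →
    Subdivision.Γ.In𝓘 X Y σ r κ → Subdivision.Γ.InU X Y σ κ →
    Subdivision.Γ.Multiplicative X Y σ κ →
    Subdivision.Γ.RankAlternating X Y σ (Subdivision.Γ.ρΓ X Y σ ρX ρY) r κ →
    (g : Subdivision.Γ.Inc X Y σ) → Subdivision.Γ.IsLeftKLS X Y σ r κ g →
    (h : Subdivision.Γ.Inc X Y σ) → Subdivision.Γ.IsPolyValued X Y σ h →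
    Subdivision.Γ._≈_ X Y σ (Subdivision.Γ.tMinus1·_ X Y σ h)
      (Subdivision.Γ._·_ X Y σ g (Subdivision.Γ.restrictXY X Y σ κ)) →
    (gInv : Subdivision.Γ.Inc X Y σ) → Subdivision.Γ.IsPolyValued X Y σ gInv →
    Subdivision.Γ.IsInverse X Y σ g gInv →
    ∀ x y → FinPoset._≤_ Y (σ x) y → ∀ n →
      Subdivision.Γ._·_ X Y σ h gInv (inj₁ x) (inj₂ y) n
        ≡ revBy (r (inj₁ x) (inj₂ y) ∸ 1)
                (Subdivision.Γ._·_ X Y σ h gInv (inj₁ x) (inj₂ y)) n
proposition3p7 X Y ρX ρY _ _ σ σ-strong r r-weak κ κ𝓘 _ κ-multiplicative κ-alternating
               g g-KLS h h-poly h-def gi _ g-inverse x y σx≤y =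
  palindromic (r (inj₁ x) (inj₂ y)) (ℓ-below (inj₁ x) (inj₂ y) σx≤y) antisymmetric
  where
  open StrongFormalSubdivision X Y ρX ρY σ σ-strong
  open Subdivision.Γ X Y σ
  open Ranked r r-weak
  open Kernel g-KLS g-inverse
  open import Relation.Binary.Reasoning.Setoid ≃-setoid

  k ℓ : Inc
  k = restrictXY κ
  ℓ = h · gi

  tMinus1·ℓ : (tMinus1· ℓ) ≃ ((g · k) · gi)
  tMinus1·ℓ = ≃-trans (tMinus1·-· h gi) (·-congˡ gi (≈⇒≃ h-def))

  k𝓘 : In𝓘 r k
  k𝓘 = restrictXY-In𝓘 r κ𝓘

  ℓ-below : BelowRank ℓ
  ℓ-below = BelowRank-· (BelowRank-cancel-tMinus1 h-poly (In𝓘-resp-≃ (≈⇒≃ h-def) (In𝓘-· g𝓘 k𝓘))) gi𝓘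

  rev-tMinus1·ℓ : rev r (tMinus1· ℓ) ≃ neg (tMinus1· ℓ)
  rev-tMinus1·ℓ = begin
    rev r (tMinus1· ℓ)   ≈⟨ rev-cong tMinus1·ℓ ⟩
    rev r ((g · k) · gi) ≈⟨ rev-conjugate k𝓘 (κ·rev-restrictXY r κ-multiplicative κ-alternating) ⟩
    neg ((g · k) · gi)   ≈⟨ neg-cong (≃-sym tMinus1·ℓ) ⟩
    neg (tMinus1· ℓ)     ∎

  antisymmetric : ∀ n → revBy (r (inj₁ x) (inj₂ y)) (tMinus1* (ℓ (inj₁ x) (inj₂ y))) n
                         ≡ - tMinus1* (ℓ (inj₁ x) (inj₂ y)) n
  antisymmetric n = trans (≃⇒≈ rev-tMinus1·ℓ (inj₁ x) (inj₂ y) σx≤y n) (ℤP.-1*i≡-i _)
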